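{- As formal series, \[M^U\!\left(xw,y,\tfrac{1}{w}\right)=\frac{w}{y}M^D(x,y,w)\qquad\text{and}\qquad M^D\!\left(xw,y,\tfrac{1}{w}\right)=wy\,M^U(x,y,w).\]
   Context: Sorting procedure: a permutation $\pi$ is processed using an input sequence (initially $\pi_1,\ldots,\pi_n$), a stack and an output. Let $m$ be the smallest value not yet output. At each step: if the stack's top entry equals $m$, pop it to the output; otherwise, if the input is nonempty, push the next input entry onto the stack. When no move is possible and the stack is nonempty, the remaining stack entries are returned to the input in the reverse of their order in the previous input (i.e. listed from top of stack to bottom), and the procedure is repeated. The rev-tier is the number of times entries must be returned to the input before the output is $1,2,\ldots,n$. For $\sigma\in S_n$, $(i,i+1)$ is a separated pair if some entry $k>i+1$ lies between $i$ and $i+1$ in $\sigma$; it is up separated if $i$ precedes $i+1$, down separated otherwise. An ISASP is a sequence of separated pairs $(i_1,i_1+1),\ldots,(i_p,i_p+1)$ with $i_1<\cdots<i_p$ and alternating orientations. $\sigma$ is up-oriented (resp. down-oriented) if it has a separated pair and every maximum length ISASP begins with an up (resp. down) separated pair. $\mu_U(n,t,k)$ (resp. $\mu_D(n,t,k)$) is the number of up-oriented (resp. down-oriented) permutations of length $n$, rev-tier $t$, with $1$ in position $k$, and $M^U(x,y,w)=\sum_{n,t,k}\mu_U(n,t,k)x^ny^tw^{k-1}$, $M^D(x,y,w)=\sum_{n,t,k}\mu_D(n,t,k)x^ny^tw^{k-1}$. -}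

module Defs where

open import Data.Bool using (Bool; true; false; not; _∧_; _∨_; if_then_else_)
open import Data.Nat using (ℕ; zero; suc; _∸_; _⊓_; _⊔_; _≡ᵇ_; _<ᵇ_)
open import Data.Integer using (ℤ; +_; -[1+_]; _+_; _-_)
open import Data.List using (List; []; _∷_; map; concatMap; length; filterᵇ;
  null; applyUpTo; take; drop; foldr)
open import Data.Bool.ListAction using (all; any)
open import Data.Product using (_×_; _,_)
import Relation.Binary.PropositionalEquality
import Data.List

-- Permutations of length n, as lists of the values 1..n (one-line notation)

insertAll : ℕ → List ℕ → List (List ℕ)
insertAll x []       = (x ∷ []) ∷ []
insertAll x (y ∷ ys) = (x ∷ y ∷ ys) ∷ map (y ∷_) (insertAll x ys)

perms : ℕ → List (List ℕ)
perms zero    = [] ∷ []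
perms (suc n) = concatMap (insertAll (suc n)) (perms n)

-- The stack sorting procedure and rev-tier
-- The stack is a list whose head is the top entry.

-- pop while the top of the stack equals m (the smallest value not yet output)
popAll : ℕ → List ℕ → ℕ × List ℕ
popAll m []       = m , []
popAll m (s ∷ ss) = if s ≡ᵇ m then popAll (suc m) ss else (m , s ∷ ss)

pass : ℕ → List ℕ → List ℕ → ℕ × List ℕ
pass m st []       = m , st
pass m st (x ∷ xs) with popAll m (x ∷ st)
... | m' , st' = pass m' st' xs

-- number of times the stack contents are returned to the input
-- (listed from top of stack to bottom, i.e. the stack list itself).
-- The first argument is fuel; each pass outputs at least one entry,
-- so fuel (suc n) suffices for a permutation of length n.
tierAux : ℕ → ℕ → List ℕ → ℕ
tierAux zero     m inp = zero
tierAux (suc f)  m inp with pass m [] inp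
... | m' , []      = zero
... | m' , (s ∷ st) = suc (tierAux f m' (s ∷ st))

revTier : List ℕ → ℕ
revTier σ = tierAux (suc (length σ)) 1 σ

-- 0-based position of value v in σ
posOf : ℕ → List ℕ → ℕ
posOf v []       = zero
posOf v (x ∷ xs) = if x ≡ᵇ v then zero else suc (posOf v xs)

between : List ℕ → ℕ → ℕ → List ℕ
between σ a b = drop (suc a) (take b σ)

separated : List ℕ → ℕ → Bool
separated σ i =
  let p = posOf i σ ; q = posOf (suc i) σ
  in any (λ k → suc i <ᵇ k) (between σ (p ⊓ q) (p ⊔ q))

isUp : List ℕ → ℕ → Bool
isUp σ i = posOf i σ <ᵇ posOf (suc i) σ

sepIdx : List ℕ → List ℕ
sepIdx σ = filterᵇ (separated σ) (applyUpTo suc (length σ ∸ 1))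

sublists : List ℕ → List (List ℕ)
sublists []       = [] ∷ []
sublists (x ∷ xs) = map (x ∷_) (sublists xs) Data.List.++ sublists xs

_≠ᵇ_ : Bool → Bool → Bool
true  ≠ᵇ b = not b
false ≠ᵇ b = b

alternating : List ℕ → List ℕ → Bool
alternating σ (i ∷ j ∷ rest) = (isUp σ i ≠ᵇ isUp σ j) ∧ alternating σ (j ∷ rest)
alternating σ _              = true

-- all ISASPs (sequences of separated pairs, increasing i, alternating orientation)
isasps : List ℕ → List (List ℕ)
isasps σ = filterᵇ (alternating σ) (sublists (sepIdx σ))

maxISASPLength : List ℕ → ℕ
maxISASPLength σ = foldr (λ s r → length s ⊔ r) zero (isasps σ)

beginsUp : List ℕ → List ℕ → Bool
beginsUp σ []      = false
beginsUp σ (i ∷ _) = isUp σ i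

beginsDown : List ℕ → List ℕ → Bool
beginsDown σ []      = false
beginsDown σ (i ∷ _) = not (isUp σ i)

upOriented : List ℕ → Bool
upOriented σ = not (null (sepIdx σ)) ∧
  all (λ s → not (length s ≡ᵇ maxISASPLength σ) ∨ beginsUp σ s) (isasps σ)

downOriented : List ℕ → Bool
downOriented σ = not (null (sepIdx σ)) ∧
  all (λ s → not (length s ≡ᵇ maxISASPLength σ) ∨ beginsDown σ s) (isasps σ)

-- Counts μ_U(n,t,k), μ_D(n,t,k)  (k = 1-based position of the entry 1)

count : (List ℕ → Bool) → List (List ℕ) → ℕ
count p xs = length (filterᵇ p xs)

μU : ℕ → ℕ → ℕ → ℕ
μU n t k = count (λ σ → upOriented σ ∧ (revTier σ ≡ᵇ t) ∧ (suc (posOf 1 σ) ≡ᵇ k)) (perms n)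

μD : ℕ → ℕ → ℕ → ℕ
μD n t k = count (λ σ → downOriented σ ∧ (revTier σ ≡ᵇ t) ∧ (suc (posOf 1 σ) ≡ᵇ k)) (perms n)

-- Formal series in x, y, w, Laurent in y and w, represented by coefficients:
-- F n t e = coefficient of x^n y^t w^e.

Series : Set
Series = ℕ → ℤ → ℤ → ℕ

-- M^U(x,y,w) = Σ μU(n,t,k) x^n y^t w^(k-1)
MU : Series
MU n (+ t) (+ e) = μU n t (suc e)
MU n _     _     = zero

MD : Series
MD n (+ t) (+ e) = μD n t (suc e)
MD n _     _     = zero

-- F(xw, y, 1/w): x^n y^t w^d ↦ x^n y^t w^(n-d)
substXW : Series → Series
substXW F n t e = F n t ((+ n) - e)

mulWOverY : Series → Series
mulWOverY F n t e = F n (t + + 1) (e - + 1)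

mulWY : Series → Series
mulWY F n t e = F n (t - + 1) (e - + 1)

_≈ₛ_ : Series → Series → Set
F ≈ₛ G = ∀ n t e → F n t e Relation.Binary.PropositionalEquality.≡ G n t e

-- Coefficientwise, both identities say: μU(n,t,a+1) = μD(n,t+1,b+1) when
-- a + b + 1 = n, and all coefficients with 1 beyond position n, or of
-- down-oriented permutations with rev-tier 0, vanish.  The bijection is
-- reversal.  Write alt σ b for the length of the greedy alternating sequence
-- of separated pairs of σ starting with orientation b (true = up).  Then
--  * reversal keeps the separated pairs and flips orientations, so
--    alt (reverse σ) b = alt σ (not b);
--  * the greedy sequence is a longest ISASP with its first orientation, so σ
--    is up-oriented iff alt σ true = alt σ false + 1 (down: symmetrically);
--  * following the procedure pass by pass (a pass outputs values until the
--    next one is blocked by a down separated pair, and the returned stack has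
--    all orientations flipped) gives revTier σ = alt σ false.
-- So reversal maps up-oriented permutations of rev-tier t with 1 in position
-- a+1 onto down-oriented ones of rev-tier t+1 with 1 in position b+1; as it
-- permutes the list of all permutations, the counts agree.
module Submission where

open import Defs
open import Data.Bool using (Bool; true; false; not; _∧_; _∨_; if_then_else_; T)
import Data.Bool.Properties as Bool
open import Data.Bool.Properties using (¬-not; not-¬; not-involutive; T-≡; ∨-assoc; ∨-comm; ∨-identityʳ; ∧-identityʳ; ∧-zeroʳ)
open import Data.Bool.ListAction using (any; all)
open import Data.Nat using (ℕ; zero; suc; _+_; _∸_; _<?_; s≤s⁻¹; _⊓_; _⊔_; _≡ᵇ_; _<ᵇ_; _≤ᵇ_; _≤_; _<_; z≤n; s≤s)
open import Data.Nat.Properties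
open import Data.Nat.Tactic.RingSolver using (solve-∀)
open import Data.Integer using (ℤ; +_; -[1+_]; _-_)
open import Data.List using (List; []; _∷_; [_]; length; _++_; reverse; _ʳ++_; filterᵇ; take; map; foldr; null; applyUpTo; concatMap)
open import Data.List.Relation.Unary.All as All using (All)
open import Data.List.Relation.Binary.Permutation.Propositional as ↭ using (_↭_; module PermutationReasoning)
open import Data.List.Relation.Binary.Permutation.Propositional.Properties using (↭-length; filter-↭; shifts; ↭-reverse; ++⁺ˡ; ++⁺)
open import Data.List.Relation.Binary.Sublist.Propositional using (_⊆_; []; _∷_; _∷ʳ_)
open import Data.List.Properties using (map-concatMap; concatMap-map; map-++; map-∘; reverse-map; ++-assoc; ++-identityʳ; length-reverse; length-++; length-++-sucʳ; unfold-reverse; reverse-++; filter-++; filter-accept; filter-reject; filter-none)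
open import Data.List.Membership.Propositional using (_∈_)
open import Data.List.Relation.Unary.Any using (here; there)
import Data.List.Relation.Unary.Any.Properties as Any
open import Data.Product using (_×_; _,_; Σ-syntax; proj₁; proj₂)
open import Data.Sum using (inj₁; inj₂; [_,_]′)
open import Data.Empty using (⊥-elim)
open import Data.Unit using (⊤; tt)
open import Function using (Equivalence; _⇔_; mk⇔; _∘_)
open import Relation.Nullary.Decidable using (T?)
open import Data.List.Membership.Propositional.Properties using (∈-filter⁻; ∈-filter⁺; ∈-map⁻; ∈-map⁺; ∈-∃++)
open import Relation.Nullary using (¬_; yes; no)
open import Relation.Binary.PropositionalEquality hiding ([_])

≡ᵇ-true⇒≡ : ∀ m n → (m ≡ᵇ n) ≡ true → m ≡ n
≡ᵇ-true⇒≡ m n e = ≡ᵇ⇒≡ m n (Equivalence.from T-≡ e)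

≡ᵇ-refl : ∀ n → (n ≡ᵇ n) ≡ true
≡ᵇ-refl n = Equivalence.to T-≡ (≡⇒≡ᵇ n n refl)

≢⇒≡ᵇ-false : ∀ m n → m ≢ n → (m ≡ᵇ n) ≡ false
≢⇒≡ᵇ-false m n m≢n with m ≡ᵇ n in e
... | true  = ⊥-elim (m≢n (≡ᵇ-true⇒≡ m n e))
... | false = refl

≡ᵇ-false⇒≢ : ∀ m n → (m ≡ᵇ n) ≡ false → m ≢ n
≡ᵇ-false⇒≢ m n e m≡n = subst T e (≡⇒≡ᵇ m n m≡n)

<ᵇ-true⇒< : ∀ m n → (m <ᵇ n) ≡ true → m < n
<ᵇ-true⇒< m n e = <ᵇ⇒< m n (Equivalence.from T-≡ e)

<⇒<ᵇ-true : ∀ m n → m < n → (m <ᵇ n) ≡ true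
<⇒<ᵇ-true m n m<n = Equivalence.to T-≡ (<⇒<ᵇ m<n)

<ᵇ-false⇒≥ : ∀ m n → (m <ᵇ n) ≡ false → n ≤ m
<ᵇ-false⇒≥ m n e = ≮⇒≥ (λ m<n → subst T e (<⇒<ᵇ m<n))

≥⇒<ᵇ-false : ∀ m n → n ≤ m → (m <ᵇ n) ≡ false
≥⇒<ᵇ-false m n n≤m with m <ᵇ n in e
... | true  = ⊥-elim (<⇒≱ (<ᵇ-true⇒< m n e) n≤m)
... | false = refl

≤ᵇ-true⇒≤ : ∀ m n → (m ≤ᵇ n) ≡ true → m ≤ n
≤ᵇ-true⇒≤ m n e = ≤ᵇ⇒≤ m n (Equivalence.from T-≡ e)

≤⇒≤ᵇ-true : ∀ m n → m ≤ n → (m ≤ᵇ n) ≡ true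
≤⇒≤ᵇ-true m n m≤n = Equivalence.to T-≡ (≤⇒≤ᵇ m≤n)

≤ᵇ-false⇒> : ∀ m n → (m ≤ᵇ n) ≡ false → n < m
≤ᵇ-false⇒> zero    n ()
≤ᵇ-false⇒> (suc m) n e = s≤s (<ᵇ-false⇒≥ m n e)

>⇒≤ᵇ-false : ∀ m n → n < m → (m ≤ᵇ n) ≡ false
>⇒≤ᵇ-false (suc m) n (s≤s n≤m) = ≥⇒<ᵇ-false m n n≤m

∈-filterᵇ⁻ : ∀ {A : Set} (p : A → Bool) {xs x} → x ∈ filterᵇ p xs → x ∈ xs × p x ≡ true
∈-filterᵇ⁻ p m with ∈-filter⁻ (T? ∘ p) m
... | x∈ , px = x∈ , Equivalence.to T-≡ px

∈-filterᵇ⁺ : ∀ {A : Set} (p : A → Bool) {xs x} → x ∈ xs → p x ≡ true → x ∈ filterᵇ p xs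
∈-filterᵇ⁺ p x∈ px = ∈-filter⁺ (T? ∘ p) x∈ (Equivalence.from T-≡ px)

all-true⁻ : ∀ {A : Set} (p : A → Bool) xs → all p xs ≡ true → ∀ {x} → x ∈ xs → p x ≡ true
all-true⁻ p (y ∷ xs) e x∈ with p y in py
all-true⁻ p (y ∷ xs) e (here refl) | true = py
all-true⁻ p (y ∷ xs) e (there x∈)  | true = all-true⁻ p xs e x∈

all-true⁺ : ∀ {A : Set} (p : A → Bool) xs → (∀ {x} → x ∈ xs → p x ≡ true) → all p xs ≡ true
all-true⁺ p []       _ = refl
all-true⁺ p (x ∷ xs) h rewrite h (here refl) = all-true⁺ p xs (λ x∈ → h (there x∈))

Distinct : List ℕ → Set
Distinct []       = ⊤
Distinct (x ∷ xs) = (¬ x ∈ xs) × Distinct xs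

Distinct-++⁻ : ∀ xs {ys} → Distinct (xs ++ ys) →
  Distinct xs × Distinct ys × (∀ {x} → x ∈ xs → ¬ x ∈ ys)
Distinct-++⁻ []       d        = tt , d , λ ()
Distinct-++⁻ (x ∷ xs) (x∉ , d) with Distinct-++⁻ xs d
... | dxs , dys , disjoint =
  ((λ m → x∉ (Any.++⁺ˡ m)) , dxs) , dys ,
  λ { (here refl) m → x∉ (Any.++⁺ʳ xs m) ; (there p) m → disjoint p m }

Distinct-++⁺ : ∀ xs {ys} → Distinct xs → Distinct ys → (∀ {x} → x ∈ xs → ¬ x ∈ ys) →
  Distinct (xs ++ ys)
Distinct-++⁺ []       _          dys _        = dys
Distinct-++⁺ (x ∷ xs) (x∉ , dxs) dys disjoint =
  (λ m → [ x∉ , disjoint (here refl) ]′ (Any.++⁻ xs m)) ,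
  Distinct-++⁺ xs dxs dys (λ p → disjoint (there p))

Distinct-reverse : ∀ xs → Distinct xs → Distinct (reverse xs)
Distinct-reverse []       _        = tt
Distinct-reverse (x ∷ xs) (x∉ , d) rewrite unfold-reverse x xs =
  Distinct-++⁺ (reverse xs) (Distinct-reverse xs d) ((λ ()) , tt)
    λ { p (here refl) → x∉ (Any.reverse⁻ p) }

Distinct-filter : ∀ (p : ℕ → Bool) xs → Distinct xs → Distinct (filterᵇ p xs)
Distinct-filter p []       _        = tt
Distinct-filter p (x ∷ xs) (x∉ , d) with p x
... | true  = (λ m → x∉ (proj₁ (∈-filterᵇ⁻ p m))) , Distinct-filter p xs d
... | false = Distinct-filter p xs d

posOf-++ : ∀ {y} u r → ¬ y ∈ u → posOf y (u ++ r) ≡ length u + posOf y r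
posOf-++     []      r _  = refl
posOf-++ {y} (x ∷ u) r y∉ rewrite ≢⇒≡ᵇ-false x y (λ e → y∉ (here (sym e))) =
  cong suc (posOf-++ u r (λ m → y∉ (there m)))

posOf-at : ∀ {y} u r → ¬ y ∈ u → posOf y (u ++ y ∷ r) ≡ length u
posOf-at {y} u r y∉ rewrite posOf-++ u (y ∷ r) y∉ | ≡ᵇ-refl y = +-identityʳ (length u)

between-after : ∀ u x r q → between (u ++ x ∷ r) (length u) (length u + suc q) ≡ take q r
between-after []      x r q = refl
between-after (y ∷ u) x r q = between-after u x r q

take-length-++ : ∀ (v r : List ℕ) → take (length v) (v ++ r) ≡ v
take-length-++ []      r = refl
take-length-++ (x ∷ v) r = cong (x ∷_) (take-length-++ v r)

-- By definition, (i,i+1) is separated in σ iff gap i (suc i) σ has an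
-- entry > i+1, and it is up iff precedes i (suc i) σ.

gap : ℕ → ℕ → List ℕ → List ℕ
gap a b s = between s (posOf a s ⊓ posOf b s) (posOf a s ⊔ posOf b s)

precedes : ℕ → ℕ → List ℕ → Bool
precedes a b s = posOf a s <ᵇ posOf b s

gap-comm : ∀ a b s → gap a b s ≡ gap b a s
gap-comm a b s = cong₂ (between s) (⊓-comm (posOf a s) _) (⊔-comm (posOf a s) _)

positions : ∀ {a b} u v w → Distinct (u ++ a ∷ v ++ b ∷ w) → a ≢ b →
  posOf a (u ++ a ∷ v ++ b ∷ w) ≡ length u ×
  posOf b (u ++ a ∷ v ++ b ∷ w) ≡ length u + suc (length v)
positions {a} {b} u v w d a≢b with Distinct-++⁻ u d
... | _ , (_ , d′) , disjoint with Distinct-++⁻ v d′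
... | _ , _ , disjoint′ =
  posOf-at u (v ++ b ∷ w) (λ m → disjoint m (here refl)) ,
  (begin
    posOf b (u ++ a ∷ v ++ b ∷ w)
  ≡⟨ posOf-++ u _ (λ m → disjoint m (there (Any.++⁺ʳ v (here refl)))) ⟩
    length u + posOf b (a ∷ v ++ b ∷ w)
  ≡⟨ cong (λ t → length u + (if t then 0 else suc (posOf b (v ++ b ∷ w))))
          (≢⇒≡ᵇ-false a b a≢b) ⟩
    length u + suc (posOf b (v ++ b ∷ w))
  ≡⟨ cong (λ t → length u + suc t) (posOf-at v w (λ m → disjoint′ m (here refl))) ⟩
    length u + suc (length v)
  ∎)
  where open ≡-Reasoning

shape-before : ∀ {a b} u v w → Distinct (u ++ a ∷ v ++ b ∷ w) → a ≢ b →
  gap a b (u ++ a ∷ v ++ b ∷ w) ≡ v × precedes a b (u ++ a ∷ v ++ b ∷ w) ≡ true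
shape-before {a} {b} u v w d a≢b with positions u v w d a≢b
... | pa , pb = gap-eq , trans (cong₂ _<ᵇ_ pa pb) (<⇒<ᵇ-true _ _ u<q)
  where
    open ≡-Reasoning
    s = u ++ a ∷ v ++ b ∷ w
    q = length u + suc (length v)
    u<q : length u < q
    u<q = m<m+n (length u) (s≤s z≤n)
    gap-eq : gap a b s ≡ v
    gap-eq = begin
      gap a b s                            ≡⟨ cong₂ (λ x y → between s (x ⊓ y) (x ⊔ y)) pa pb ⟩
      between s (length u ⊓ q) (length u ⊔ q)
        ≡⟨ cong₂ (between s) (m≤n⇒m⊓n≡m (<⇒≤ u<q)) (m≤n⇒m⊔n≡n (<⇒≤ u<q)) ⟩
      between s (length u) q               ≡⟨ between-after u a (v ++ b ∷ w) (length v) ⟩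
      take (length v) (v ++ b ∷ w)         ≡⟨ take-length-++ v (b ∷ w) ⟩
      v                                    ∎

shape-after : ∀ {a b} u v w → Distinct (u ++ b ∷ v ++ a ∷ w) → a ≢ b →
  gap a b (u ++ b ∷ v ++ a ∷ w) ≡ v × precedes a b (u ++ b ∷ v ++ a ∷ w) ≡ false
shape-after {a} {b} u v w d a≢b with positions u v w d (λ e → a≢b (sym e))
... | pb , pa =
  trans (gap-comm a b (u ++ b ∷ v ++ a ∷ w)) (proj₁ (shape-before u v w d (λ e → a≢b (sym e)))) ,
  trans (cong₂ _<ᵇ_ pa pb) (≥⇒<ᵇ-false _ _ (m≤m+n (length u) _))

data PairView (s : List ℕ) (a b : ℕ) : Set where
  a-first : ∀ u v w → s ≡ u ++ a ∷ v ++ b ∷ w → PairView s a b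
  b-first : ∀ u v w → s ≡ u ++ b ∷ v ++ a ∷ w → PairView s a b

pairView : ∀ s {a b} → a ∈ s → b ∈ s → a ≢ b → PairView s a b
pairView s {a} {b} a∈ b∈ a≢b with ∈-∃++ a∈
... | u , r , refl with Any.++⁻ u b∈
... | inj₁ b∈u with ∈-∃++ b∈u
...   | u₁ , u₂ , refl = b-first u₁ u₂ r (++-assoc u₁ (b ∷ u₂) (a ∷ r))
pairView s {a} {b} a∈ b∈ a≢b | u , r , refl | inj₂ (here e)  = ⊥-elim (a≢b (sym e))
pairView s {a} {b} a∈ b∈ a≢b | u , r , refl | inj₂ (there b∈r) with ∈-∃++ b∈r
... | v , w , refl = a-first u v w refl

reverse-decomp : ∀ (u : List ℕ) a v b w →
  reverse (u ++ a ∷ v ++ b ∷ w) ≡ reverse w ++ b ∷ reverse v ++ a ∷ reverse u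
reverse-decomp u a v b w = begin
  reverse (u ++ a ∷ v ++ b ∷ w)                       ≡⟨ reverse-++ u (a ∷ v ++ b ∷ w) ⟩
  reverse (a ∷ v ++ b ∷ w) ++ reverse u               ≡⟨ cong (_++ reverse u) (unfold-reverse a (v ++ b ∷ w)) ⟩
  (reverse (v ++ b ∷ w) ++ [ a ]) ++ reverse u        ≡⟨ ++-assoc (reverse (v ++ b ∷ w)) [ a ] (reverse u) ⟩
  reverse (v ++ b ∷ w) ++ a ∷ reverse u               ≡⟨ cong (_++ a ∷ reverse u) (reverse-++ v (b ∷ w)) ⟩
  (reverse (b ∷ w) ++ reverse v) ++ a ∷ reverse u     ≡⟨ ++-assoc (reverse (b ∷ w)) (reverse v) (a ∷ reverse u) ⟩
  reverse (b ∷ w) ++ reverse v ++ a ∷ reverse u       ≡⟨ cong (_++ reverse v ++ a ∷ reverse u) (unfold-reverse b w) ⟩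
  (reverse w ++ [ b ]) ++ reverse v ++ a ∷ reverse u  ≡⟨ ++-assoc (reverse w) [ b ] (reverse v ++ a ∷ reverse u) ⟩
  reverse w ++ b ∷ reverse v ++ a ∷ reverse u         ∎
  where open ≡-Reasoning

reverse-pair : ∀ s {a b} → Distinct s → a ∈ s → b ∈ s → a ≢ b →
  gap a b (reverse s) ≡ reverse (gap a b s) × precedes a b (reverse s) ≡ not (precedes a b s)
reverse-pair s {a} {b} d a∈ b∈ a≢b with pairView s a∈ b∈ a≢b
... | a-first u v w refl =
  let r≡ = reverse-decomp u a v b w
      (g , p)   = shape-before u v w d a≢b
      (g′ , p′) = shape-after (reverse w) (reverse v) (reverse u)
                    (subst Distinct r≡ (Distinct-reverse s d)) a≢b
  in trans (cong (gap a b) r≡) (trans g′ (cong reverse (sym g))) ,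
     trans (cong (precedes a b) r≡) (trans p′ (cong not (sym p)))
... | b-first u v w refl =
  let r≡ = reverse-decomp u b v a w
      (g , p)   = shape-after u v w d a≢b
      (g′ , p′) = shape-before (reverse w) (reverse v) (reverse u)
                    (subst Distinct r≡ (Distinct-reverse s d)) a≢b
  in trans (cong (gap a b) r≡) (trans g′ (cong reverse (sym g))) ,
     trans (cong (precedes a b) r≡) (trans p′ (cong not (sym p)))

filter-decomp : ∀ (p : ℕ → Bool) u a v b w → p a ≡ true → p b ≡ true →
  filterᵇ p (u ++ a ∷ v ++ b ∷ w) ≡ filterᵇ p u ++ a ∷ filterᵇ p v ++ b ∷ filterᵇ p w
filter-decomp p u a v b w pa pb
  rewrite filter-++ (T? ∘ p) u (a ∷ v ++ b ∷ w) | pa | filter-++ (T? ∘ p) v (b ∷ w) | pb = refl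

filter-pair : ∀ (p : ℕ → Bool) s {a b} → Distinct s → a ∈ s → b ∈ s → a ≢ b →
  p a ≡ true → p b ≡ true →
  gap a b (filterᵇ p s) ≡ filterᵇ p (gap a b s) × precedes a b (filterᵇ p s) ≡ precedes a b s
filter-pair p s {a} {b} d a∈ b∈ a≢b pa pb with pairView s a∈ b∈ a≢b
... | a-first u v w refl =
  let f≡ = filter-decomp p u a v b w pa pb
      (g , q)   = shape-before u v w d a≢b
      (g′ , q′) = shape-before (filterᵇ p u) (filterᵇ p v) (filterᵇ p w)
                    (subst Distinct f≡ (Distinct-filter p s d)) a≢b
  in trans (cong (gap a b) f≡) (trans g′ (cong (filterᵇ p) (sym g))) ,
     trans (cong (precedes a b) f≡) (trans q′ (sym q))
... | b-first u v w refl =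
  let f≡ = filter-decomp p u b v a w pb pa
      (g , q)   = shape-after u v w d a≢b
      (g′ , q′) = shape-after (filterᵇ p u) (filterᵇ p v) (filterᵇ p w)
                    (subst Distinct f≡ (Distinct-filter p s d)) a≢b
  in trans (cong (gap a b) f≡) (trans g′ (cong (filterᵇ p) (sym g))) ,
     trans (cong (precedes a b) f≡) (trans q′ (sym q))

any-++ : ∀ (q : ℕ → Bool) xs ys → any q (xs ++ ys) ≡ any q xs ∨ any q ys
any-++ q []       ys = refl
any-++ q (x ∷ xs) ys = trans (cong (q x ∨_) (any-++ q xs ys)) (sym (∨-assoc (q x) _ _))

any-reverse : ∀ (q : ℕ → Bool) xs → any q (reverse xs) ≡ any q xs
any-reverse q []       = refl
any-reverse q (x ∷ xs) = begin
  any q (reverse (x ∷ xs))        ≡⟨ cong (any q) (unfold-reverse x xs) ⟩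
  any q (reverse xs ++ [ x ])     ≡⟨ any-++ q (reverse xs) [ x ] ⟩
  any q (reverse xs) ∨ (q x ∨ false) ≡⟨ cong₂ _∨_ (any-reverse q xs) (∨-identityʳ (q x)) ⟩
  any q xs ∨ q x                  ≡⟨ ∨-comm (any q xs) (q x) ⟩
  q x ∨ any q xs                  ∎
  where open ≡-Reasoning

any-filter : ∀ (q p : ℕ → Bool) xs → (∀ z → q z ≡ true → p z ≡ true) →
  any q (filterᵇ p xs) ≡ any q xs
any-filter q p []       keeps = refl
any-filter q p (x ∷ xs) keeps with q x in qx
... | true  rewrite keeps x qx | qx = refl
... | false with p x
...   | true  rewrite qx = any-filter q p xs keeps
...   | false = any-filter q p xs keeps

i≢1+i : ∀ i → i ≢ suc i
i≢1+i i e = 1+n≢n (sym e)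

separated-reverse : ∀ σ i → Distinct σ → i ∈ σ → suc i ∈ σ →
  separated (reverse σ) i ≡ separated σ i
separated-reverse σ i d i∈ i+1∈ =
  trans (cong (any (suc i <ᵇ_)) (proj₁ (reverse-pair σ d i∈ i+1∈ (i≢1+i i))))
        (any-reverse (suc i <ᵇ_) (gap i (suc i) σ))

isUp-reverse : ∀ σ i → Distinct σ → i ∈ σ → suc i ∈ σ → isUp (reverse σ) i ≡ not (isUp σ i)
isUp-reverse σ i d i∈ i+1∈ = proj₂ (reverse-pair σ d i∈ i+1∈ (i≢1+i i))

separated-filter : ∀ (p : ℕ → Bool) σ i → Distinct σ → i ∈ σ → suc i ∈ σ →
  p i ≡ true → p (suc i) ≡ true → (∀ z → suc i < z → p z ≡ true) →
  separated (filterᵇ p σ) i ≡ separated σ i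
separated-filter p σ i d i∈ i+1∈ pi pi+1 keeps =
  trans (cong (any (suc i <ᵇ_)) (proj₁ (filter-pair p σ d i∈ i+1∈ (i≢1+i i) pi pi+1)))
        (any-filter (suc i <ᵇ_) p (gap i (suc i) σ) (λ z lt → keeps z (<ᵇ-true⇒< _ _ lt)))

isUp-filter : ∀ (p : ℕ → Bool) σ i → Distinct σ → i ∈ σ → suc i ∈ σ →
  p i ≡ true → p (suc i) ≡ true → isUp (filterᵇ p σ) i ≡ isUp σ i
isUp-filter p σ i d i∈ i+1∈ pi pi+1 = proj₂ (filter-pair p σ d i∈ i+1∈ (i≢1+i i) pi pi+1)

-- In the list r of entries read so far (newest first), (j,j+1) is separated
-- and j is ahead of j+1: in reading order, a down separated pair.
downSep : List ℕ → ℕ → Bool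
downSep r j = separated r j ∧ isUp r j

downSep-∷ : ∀ x r j → x ≢ j → x ≢ suc j → downSep (x ∷ r) j ≡ downSep r j
downSep-∷ x r j x≢j x≢j+1 rewrite ≢⇒≡ᵇ-false x j x≢j | ≢⇒≡ᵇ-false x (suc j) x≢j+1 = refl

before : ℕ → List ℕ → List ℕ
before t xs = take (posOf t xs) xs

downSep-∷-above : ∀ x r j → suc j < x → downSep (x ∷ r) j ≡ downSep r j
downSep-∷-above x r j j+1<x = downSep-∷ x r j (λ q → <⇒≢ (<-trans (n<1+n j) j+1<x) (sym q)) (λ q → <⇒≢ j+1<x (sym q))

downSep-∷-below : ∀ x r j → x < j → downSep (x ∷ r) j ≡ downSep r j
downSep-∷-below x r j x<j = downSep-∷ x r j (<⇒≢ x<j) (<⇒≢ (≤-trans x<j (n≤1+n j)))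

downSep-head : ∀ j r → downSep (j ∷ r) j ≡ any (suc j <ᵇ_) (before (suc j) r)
downSep-head j r rewrite ≡ᵇ-refl j | ≢⇒≡ᵇ-false j (suc j) (i≢1+i j) = ∧-identityʳ _

-- If j+1 is the newest entry, it was read after j.
downSep-next-head : ∀ j r → downSep (suc j ∷ r) j ≡ false
downSep-next-head j r rewrite ≢⇒≡ᵇ-false (suc j) j 1+n≢n | ≡ᵇ-refl (suc j) = ∧-zeroʳ _

-- The stack, when the entries r (newest first) have been read and m is the
-- smallest value not yet output: the read entries that are still ≥ m.
stack : ℕ → List ℕ → List ℕ
stack m r = filterᵇ (m ≤ᵇ_) r

on-stack : ∀ m r {x} → x ∈ r → m ≤ x → x ∈ stack m r
on-stack m r x∈ m≤x = ∈-filterᵇ⁺ (m ≤ᵇ_) x∈ (≤⇒≤ᵇ-true m _ m≤x)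

-- A value k that was never read is not on the stack, so it does not matter
-- whether it counts as output.
stack-skip : ∀ k r → ¬ k ∈ r → stack k r ≡ stack (suc k) r
stack-skip k []      _  = refl
stack-skip k (x ∷ r) k∉ with k ≤ᵇ x in e
... | true  rewrite ≤⇒≤ᵇ-true (suc k) x (≤∧≢⇒< (≤ᵇ-true⇒≤ k x e) (λ q → k∉ (here q))) =
  cong (x ∷_) (stack-skip k r (λ m → k∉ (there m)))
... | false rewrite >⇒≤ᵇ-false (suc k) x (≤-trans (≤ᵇ-false⇒> k x e) (n≤1+n k)) =
  stack-skip k r (λ m → k∉ (there m))

stack-head : ∀ k r t → Distinct r → stack k r ≡ k ∷ t → stack (suc k) r ≡ t
stack-head k []      t _        ()
stack-head k (x ∷ r) t (x∉ , d) h with k ≤ᵇ x in e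
... | true with h
...   | refl rewrite >⇒≤ᵇ-false (suc x) x ≤-refl = sym (stack-skip x r x∉)
stack-head k (x ∷ r) t (x∉ , d) h | false
  rewrite >⇒≤ᵇ-false (suc k) x (≤-trans (≤ᵇ-false⇒> k x e) (n≤1+n k)) = stack-head k r t d h

noneLargerBefore : ∀ t r tl → stack t r ≡ t ∷ tl → any (t <ᵇ_) (before t r) ≡ false
noneLargerBefore t []      tl ()
noneLargerBefore t (z ∷ r) tl h with z ≡ᵇ t in e
... | true  = refl
... | false with t ≤ᵇ z in e′
...   | true  with h
...     | refl = ⊥-elim (≡ᵇ-false⇒≢ z z e refl)
noneLargerBefore t (z ∷ r) tl h | false | false
  rewrite ≥⇒<ᵇ-false t z (<⇒≤ (≤ᵇ-false⇒> t z e′)) = noneLargerBefore t r tl h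

someLargerBefore : ∀ t r y tl → t ∈ r → stack t r ≡ y ∷ tl → y ≢ t →
  any (t <ᵇ_) (before t r) ≡ true
someLargerBefore t (z ∷ r) y tl t∈ h y≢t with z ≡ᵇ t in e
... | true rewrite ≡ᵇ-true⇒≡ z t e | ≤⇒≤ᵇ-true t t ≤-refl with h
...   | refl = ⊥-elim (y≢t refl)
someLargerBefore t (z ∷ r) y tl t∈ h y≢t | false with t ≤ᵇ z in e′
... | true rewrite <⇒<ᵇ-true t z (≤∧≢⇒< (≤ᵇ-true⇒≤ t z e′) (λ q → ≡ᵇ-false⇒≢ z t e (sym q))) = refl
... | false rewrite ≥⇒<ᵇ-false t z (<⇒≤ (≤ᵇ-false⇒> t z e′)) with t∈
...   | here q   = ⊥-elim (≡ᵇ-false⇒≢ z t e (sym q))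
...   | there t∈r = someLargerBefore t r y tl t∈r h y≢t

next-below⇒¬downSep : ∀ j r tl t → stack j r ≡ j ∷ tl → stack (suc j) r ≡ suc j ∷ t →
  downSep r j ≡ false
next-below⇒¬downSep j []      tl t () _
next-below⇒¬downSep j (x ∷ r) tl t h₁ h₂ with j ≤ᵇ x in e
... | true with h₁
...   | refl rewrite >⇒≤ᵇ-false (suc x) x ≤-refl =
  trans (downSep-head x r) (noneLargerBefore (suc x) r t h₂)
next-below⇒¬downSep j (x ∷ r) tl t h₁ h₂ | false
  rewrite >⇒≤ᵇ-false (suc j) x (≤-trans (≤ᵇ-false⇒> j x e) (n≤1+n j)) =
  trans (downSep-∷-below x r j (≤ᵇ-false⇒> j x e)) (next-below⇒¬downSep j r tl t h₁ h₂)

next-buried⇒downSep : ∀ j r tl y t → stack j r ≡ j ∷ tl → suc j ∈ r →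
  stack (suc j) r ≡ y ∷ t → y ≢ suc j → downSep r j ≡ true
next-buried⇒downSep j []      tl y t () _ _ _
next-buried⇒downSep j (x ∷ r) tl y t h₁ j+1∈ h₂ y≢ with j ≤ᵇ x in e
... | true with h₁
...   | refl rewrite >⇒≤ᵇ-false (suc x) x ≤-refl with j+1∈
...     | here q    = ⊥-elim (i≢1+i x (sym q))
...     | there j+1∈r = trans (downSep-head x r) (someLargerBefore (suc x) r y t j+1∈r h₂ y≢)
next-buried⇒downSep j (x ∷ r) tl y t h₁ j+1∈ h₂ y≢ | false
  rewrite >⇒≤ᵇ-false (suc j) x (≤-trans (≤ᵇ-false⇒> j x e) (n≤1+n j)) =
  trans (downSep-∷-below x r j x<j)
    (next-buried⇒downSep j r tl y t h₁ (tail-∈ j+1∈ (λ q → <⇒≢ (≤-trans x<j (n≤1+n j)) (sym q))) h₂ y≢)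
  where
    x<j = ≤ᵇ-false⇒> j x e
    tail-∈ : ∀ {z} → z ∈ x ∷ r → z ≢ x → z ∈ r
    tail-∈ (here q)  z≢x = ⊥-elim (z≢x q)
    tail-∈ (there m) _   = m

-- Invariant of one pass started with m₀ the smallest value not yet output,
-- after reading the entries r (newest first), with m now the smallest value
-- not yet output.
record PassInvariant (m₀ : ℕ) (r : List ℕ) (m : ℕ) : Set where
  field
    start≤next  : m₀ ≤ m
    outputRead  : ∀ j → m₀ ≤ j → j < m → j ∈ r
    noDownBelow : ∀ j → m₀ ≤ j → suc j < m → downSep r j ≡ false
    -- if m has been read, it is blocked: (m-1,m) is a down separated pair
    nextBlocked : m ∈ r → Σ[ j ∈ ℕ ] m ≡ suc j × m₀ ≤ j × downSep r j ≡ true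

passInvariant-start : ∀ m₀ → PassInvariant m₀ [] m₀
passInvariant-start m₀ = record
  { start≤next  = ≤-refl
  ; outputRead  = λ j m₀≤j j<m₀ → ⊥-elim (<⇒≱ j<m₀ m₀≤j)
  ; noDownBelow = λ j m₀≤j j+1<m₀ → ⊥-elim (<⇒≱ (<-trans (n<1+n j) j+1<m₀) m₀≤j)
  ; nextBlocked = λ ()
  }

popLoop : ∀ m₀ j r st → st ≡ stack (suc j) r → Distinct r →
  (Σ[ tl ∈ List ℕ ] stack j r ≡ j ∷ tl) → m₀ ≤ j →
  (∀ i → m₀ ≤ i → i < suc j → i ∈ r) → (∀ i → m₀ ≤ i → suc i < suc j → downSep r i ≡ false) →
  Σ[ m′ ∈ ℕ ] popAll (suc j) st ≡ (m′ , stack m′ r) × PassInvariant m₀ r m′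
popLoop m₀ j r [] st≡ d _ m₀≤j read noDown = suc j , cong (suc j ,_) st≡ , record
  { start≤next  = ≤-trans m₀≤j (n≤1+n j)
  ; outputRead  = read
  ; noDownBelow = noDown
  ; nextBlocked = λ j+1∈ → ⊥-elim (Any.¬Any[] (subst (suc j ∈_) (sym st≡) (on-stack (suc j) r j+1∈ ≤-refl)))
  }
popLoop m₀ j r (y ∷ st) st≡ d (tl , top) m₀≤j read noDown with y ≡ᵇ suc j in e
... | true with ≡ᵇ-true⇒≡ y (suc j) e
...   | refl = popLoop m₀ (suc j) r st (sym (stack-head (suc j) r st d (sym st≡))) d
               (st , sym st≡) (≤-trans m₀≤j (n≤1+n j)) read′ noDown′
  where
    read′ : ∀ i → m₀ ≤ i → i < suc (suc j) → i ∈ r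
    read′ i m₀≤i i<j+2 with m<1+n⇒m<n∨m≡n i<j+2
    ... | inj₁ i<j+1 = read i m₀≤i i<j+1
    ... | inj₂ refl  = proj₁ (∈-filterᵇ⁻ (suc j ≤ᵇ_) (subst (suc j ∈_) st≡ (here refl)))
    noDown′ : ∀ i → m₀ ≤ i → suc i < suc (suc j) → downSep r i ≡ false
    noDown′ i m₀≤i (s≤s i<j+1) with m<1+n⇒m<n∨m≡n i<j+1
    ... | inj₁ i<j = noDown i m₀≤i (s≤s i<j)
    ... | inj₂ refl = next-below⇒¬downSep i r tl st top (sym st≡)
popLoop m₀ j r (y ∷ st) st≡ d (tl , top) m₀≤j read noDown | false = suc j , cong (suc j ,_) st≡ , record
  { start≤next  = ≤-trans m₀≤j (n≤1+n j)
  ; outputRead  = read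
  ; noDownBelow = noDown
  ; nextBlocked = λ j+1∈ → j , refl , m₀≤j ,
      next-buried⇒downSep j r tl y st top j+1∈ (sym st≡) (≡ᵇ-false⇒≢ y (suc j) e)
  }

push-stays : ∀ m₀ x r m → ¬ x ∈ r → m₀ ≤ x → x ≢ m → PassInvariant m₀ r m →
  popAll m (x ∷ stack m r) ≡ (m , stack m (x ∷ r)) × PassInvariant m₀ (x ∷ r) m
push-stays m₀ x r m x∉ m₀≤x x≢m inv rewrite ≢⇒≡ᵇ-false x m x≢m =
  cong (m ,_) (sym (filter-accept (T? ∘ (m ≤ᵇ_)) (≤⇒≤ᵇ m≤x))) , record
    { start≤next  = start≤next
    ; outputRead  = λ j m₀≤j j<m → there (outputRead j m₀≤j j<m)
    ; noDownBelow = λ j m₀≤j j+1<m →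
        trans (downSep-∷-above x r j (≤-trans j+1<m m≤x)) (noDownBelow j m₀≤j j+1<m)
    ; nextBlocked = λ
        { (here m≡x) → ⊥-elim (x≢m (sym m≡x))
        ; (there m∈) → let (j , m≡ , m₀≤j , down) = nextBlocked m∈ in
            j , m≡ , m₀≤j ,
            trans (downSep-∷-above x r j (≤∧≢⇒< (subst (_≤ x) m≡ m≤x) (λ q → x≢m (trans (sym q) (sym m≡)))))
                  down
        }
    }
  where
    open PassInvariant inv
    -- x was not output before, so x ≥ m
    m≤x : m ≤ x
    m≤x = ≮⇒≥ (λ x<m → x∉ (outputRead x m₀≤x x<m))

push-outputs : ∀ m₀ m r → Distinct (m ∷ r) → PassInvariant m₀ r m →
  Σ[ m′ ∈ ℕ ] popAll m (m ∷ stack m r) ≡ (m′ , stack m′ (m ∷ r)) × PassInvariant m₀ (m ∷ r) m′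
push-outputs m₀ m r (m∉ , d) inv rewrite ≡ᵇ-refl m =
  popLoop m₀ m (m ∷ r) (stack m r)
    (trans (stack-skip m r m∉) (sym (filter-reject (T? ∘ (suc m ≤ᵇ_)) {m} {r} (λ t → <-irrefl refl (≤ᵇ⇒≤ (suc m) m t)))))
    (m∉ , d) (stack m r , filter-accept (T? ∘ (m ≤ᵇ_)) {m} {r} (≤⇒≤ᵇ (≤-refl {m}))) start≤next read noDown
  where
    open PassInvariant inv
    read : ∀ i → m₀ ≤ i → i < suc m → i ∈ m ∷ r
    read i m₀≤i i<m+1 with m<1+n⇒m<n∨m≡n i<m+1
    ... | inj₁ i<m = there (outputRead i m₀≤i i<m)
    ... | inj₂ refl = here refl
    noDown : ∀ i → m₀ ≤ i → suc i < suc m → downSep (m ∷ r) i ≡ false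
    noDown i m₀≤i (s≤s i<m) with m≤n⇒m<n∨m≡n i<m
    ... | inj₁ i+1<m = trans (downSep-∷-above m r i i+1<m) (noDownBelow i m₀≤i i+1<m)
    ... | inj₂ refl  = downSep-next-head i r

pushStep : ∀ m₀ x r m → Distinct (x ∷ r) → m₀ ≤ x → PassInvariant m₀ r m →
  Σ[ m′ ∈ ℕ ] popAll m (x ∷ stack m r) ≡ (m′ , stack m′ (x ∷ r)) × PassInvariant m₀ (x ∷ r) m′
pushStep m₀ x r m d m₀≤x inv with x ≟ m
... | yes refl = push-outputs m₀ x r d inv
... | no x≢m   = m , push-stays m₀ x r m (proj₁ d) m₀≤x x≢m inv

Distinct-ʳ++ : ∀ xs r → Distinct (xs ʳ++ r) → Distinct r
Distinct-ʳ++ []       r d = d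
Distinct-ʳ++ (x ∷ xs) r d = proj₂ (Distinct-ʳ++ xs (x ∷ r) d)

passLoop : ∀ m₀ xs r m → Distinct (xs ʳ++ r) → All (m₀ ≤_) xs → PassInvariant m₀ r m →
  Σ[ m′ ∈ ℕ ] pass m (stack m r) xs ≡ (m′ , stack m′ (xs ʳ++ r)) × PassInvariant m₀ (xs ʳ++ r) m′
passLoop m₀ []       r m d _              inv = m , refl , inv
passLoop m₀ (x ∷ xs) r m d (m₀≤x All.∷ m₀≤xs) inv
  with popAll m (x ∷ stack m r) | pushStep m₀ x r m (Distinct-ʳ++ xs (x ∷ r) d) m₀≤x inv
... | _ | m′ , refl , inv′ = passLoop m₀ xs (x ∷ r) m′ d m₀≤xs inv′

passSpec : ∀ m₀ s → Distinct (reverse s) → All (m₀ ≤_) s →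
  Σ[ m′ ∈ ℕ ] pass m₀ [] s ≡ (m′ , stack m′ (reverse s)) × PassInvariant m₀ (reverse s) m′
passSpec m₀ s d m₀≤s = passLoop m₀ s [] m₀ d m₀≤s (passInvariant-start m₀)

record PermOf (m k : ℕ) (s : List ℕ) : Set where
  field
    distinct : Distinct s
    bounded  : ∀ {x} → x ∈ s → m ≤ x × x < m + k
    complete : ∀ {x} → m ≤ x → x < m + k → x ∈ s

PermOf-stack : ∀ m k s t l → PermOf m k s → m ≤ t → t + l ≡ m + k → PermOf t l (stack t (reverse s))
PermOf-stack m k s t l perm m≤t bound = record
  { distinct = Distinct-filter (t ≤ᵇ_) (reverse s) (Distinct-reverse s distinct)
  ; bounded  = λ {x} x∈ → let (x∈s , t≤x) = ∈-filterᵇ⁻ (t ≤ᵇ_) x∈ in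
      ≤ᵇ-true⇒≤ t x t≤x , subst (x <_) (sym bound) (proj₂ (bounded (Any.reverse⁻ x∈s)))
  ; complete = λ {x} t≤x x<t+l →
      on-stack t (reverse s) (Any.reverse⁺ (complete (≤-trans m≤t t≤x) (subst (x <_) bound x<t+l))) t≤x
  }
  where open PermOf perm

PermOf-pair : ∀ {m k s i} → PermOf m k s → m ≤ i → suc i < m + k → i ∈ s × suc i ∈ s
PermOf-pair perm m≤i i+1<m+k =
  complete m≤i (<-trans (n<1+n _) i+1<m+k) , complete (≤-trans m≤i (n≤1+n _)) i+1<m+k
  where open PermOf perm

downSep-reverse : ∀ m k s j → PermOf m k s → m ≤ j → suc j < m + k →
  downSep (reverse s) j ≡ separated s j ∧ not (isUp s j)
downSep-reverse m k s j perm m≤j j+1<m+k with PermOf-pair perm m≤j j+1<m+k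
... | j∈ , j+1∈ = cong₂ _∧_ (separated-reverse s j d j∈ j+1∈) (isUp-reverse s j d j∈ j+1∈)
  where d = PermOf.distinct perm

stack-pair : ∀ m k s t i → PermOf m k s → m ≤ t → t ≤ i → suc i < m + k →
  separated (stack t (reverse s)) i ≡ separated s i × isUp (stack t (reverse s)) i ≡ not (isUp s i)
stack-pair m k s t i perm m≤t t≤i i+1<m+k with PermOf-pair perm (≤-trans m≤t t≤i) i+1<m+k
... | i∈ , i+1∈ =
  trans (separated-filter P r i dr (Any.reverse⁺ i∈) (Any.reverse⁺ i+1∈) Pi Pi+1 keeps)
        (separated-reverse s i d i∈ i+1∈) ,
  trans (isUp-filter P r i dr (Any.reverse⁺ i∈) (Any.reverse⁺ i+1∈) Pi Pi+1)
        (isUp-reverse s i d i∈ i+1∈)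
  where
    d = PermOf.distinct perm
    r = reverse s
    dr = Distinct-reverse s d
    P = t ≤ᵇ_
    Pi = ≤⇒≤ᵇ-true t i t≤i
    Pi+1 = ≤⇒≤ᵇ-true t (suc i) (≤-trans t≤i (n≤1+n i))
    keeps : ∀ z → suc i < z → P z ≡ true
    keeps z i+1<z = ≤⇒≤ᵇ-true t z (≤-trans t≤i (≤-trans (n≤1+n i) (<⇒≤ i+1<z)))

interval : ℕ → ℕ → List ℕ
interval a zero    = []
interval a (suc l) = a ∷ interval (suc a) l

interval-split : ∀ a l c → interval a (l + suc c) ≡ interval a l ++ (a + l) ∷ interval (suc (a + l)) c
interval-split a zero    c rewrite +-identityʳ a = refl
interval-split a (suc l) c rewrite interval-split (suc a) l c | +-suc a l = refl

OnInterval : (ℕ → Set) → ℕ → ℕ → Set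
OnInterval P a l = ∀ i → a ≤ i → i < a + l → P i

OnInterval-head : ∀ {P} a l → OnInterval P a (suc l) → P a
OnInterval-head a l h = h a ≤-refl (subst (a <_) (sym (+-suc a l)) (s≤s (m≤m+n a l)))

OnInterval-tail : ∀ {P} a l → OnInterval P a (suc l) → OnInterval P (suc a) l
OnInterval-tail a l h i a<i i<a+1+l = h i (≤-trans (n≤1+n a) a<i) (subst (i <_) (sym (+-suc a l)) i<a+1+l)

-- greedy sp up b is: scan the indices is from left to right, wanting
-- orientation b (true = up) first; pick each i with sp i whose orientation
-- up i is the wanted one, and then want the other orientation.
greedy : (ℕ → Bool) → (ℕ → Bool) → Bool → List ℕ → ℕ
greedy sp up b     [] = 0
greedy sp up true  (i ∷ is) =
  if sp i then (if up i then suc (greedy sp up false is) else greedy sp up true is)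
  else greedy sp up true is
greedy sp up false (i ∷ is) =
  if sp i then (if up i then greedy sp up false is else suc (greedy sp up true is))
  else greedy sp up false is

greedyIn : List ℕ → Bool → List ℕ → ℕ
greedyIn σ = greedy (separated σ) (isUp σ)

greedy-down-head : ∀ sp up i is → (sp i ∧ not (up i)) ≡ true →
  greedy sp up false (i ∷ is) ≡ suc (greedy sp up true is)
greedy-down-head sp up i is e with sp i | up i | e
... | true  | false | _ = refl
... | true  | true  | ()
... | false | _     | ()

greedy-skip : ∀ sp up a l ys → OnInterval (λ i → (sp i ∧ not (up i)) ≡ false) a l →
  greedy sp up false (interval a l ++ ys) ≡ greedy sp up false ys
greedy-skip sp up a zero    ys none = refl
greedy-skip sp up a (suc l) ys none with sp a | up a | OnInterval-head a l none
... | true  | true  | _ = greedy-skip sp up (suc a) l ys (OnInterval-tail a l none)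
... | false | _     | _ = greedy-skip sp up (suc a) l ys (OnInterval-tail a l none)
... | true  | false | ()

greedy-none : ∀ sp up a l → OnInterval (λ i → (sp i ∧ not (up i)) ≡ false) a l →
  greedy sp up false (interval a l) ≡ 0
greedy-none sp up a l none =
  trans (cong (greedy sp up false) (sym (++-identityʳ (interval a l)))) (greedy-skip sp up a l [] none)

greedy-flip : ∀ sp up sp′ up′ a l → OnInterval (λ i → sp′ i ≡ sp i × up′ i ≡ not (up i)) a l →
  ∀ b → greedy sp up b (interval a l) ≡ greedy sp′ up′ (not b) (interval a l)
greedy-flip sp up sp′ up′ a zero    flips b = refl
greedy-flip sp up sp′ up′ a (suc l) flips true
  with OnInterval-head a l flips | greedy-flip sp up sp′ up′ (suc a) l (OnInterval-tail a l flips)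
... | sp′a , up′a | rest rewrite sp′a | up′a with sp a | up a
... | false | _     = rest true
... | true  | true  = cong suc (rest false)
... | true  | false = rest true
greedy-flip sp up sp′ up′ a (suc l) flips false
  with OnInterval-head a l flips | greedy-flip sp up sp′ up′ (suc a) l (OnInterval-tail a l flips)
... | sp′a , up′a | rest rewrite sp′a | up′a with sp a | up a
... | false | _     = rest false
... | true  | true  = rest false
... | true  | false = cong suc (rest true)

no-down-output : ∀ m k s m′ i → PermOf m k s → PassInvariant m (reverse s) m′ →
  m ≤ i → suc i < m′ → suc i < m + k → (separated s i ∧ not (isUp s i)) ≡ false
no-down-output m k s m′ i perm inv m≤i i+1<m′ i+1<m+k =
  trans (sym (downSep-reverse m k s i perm m≤i i+1<m+k)) (PassInvariant.noDownBelow inv i m≤i i+1<m′)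

-- After outputting m, …, m+a, the values m+a+1, …, m+a+c+1 remain.
round-length : ∀ m a c → suc (m + a) + suc c ≡ m + suc (suc (a + c))
round-length = solve-∀

-- If the first pass
-- over s (an arrangement of m, …, m+k-1, k = a+c+2) outputs m, …, j = m+a and
-- stops with j+1 blocked, then the greedy alternating sequence of s starting
-- with a down pair picks j first (all earlier pairs are not down separated),
-- and continues like the greedy sequence of the next input starting with a
-- down pair (the next input flips all orientations).
tier-step : ∀ m a c s → PermOf m (suc (suc (a + c))) s →
  PassInvariant m (reverse s) (suc (m + a)) → downSep (reverse s) (m + a) ≡ true →
  greedyIn s false (interval m (suc (a + c))) ≡
  suc (greedyIn (stack (suc (m + a)) (reverse s)) false (interval (suc (m + a)) c))
tier-step m a c s perm inv down = begin
    greedyIn s false (interval m (suc (a + c)))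
  ≡⟨ cong (λ z → greedyIn s false (interval m z)) (sym (+-suc a c)) ⟩
    greedyIn s false (interval m (a + suc c))
  ≡⟨ cong (greedyIn s false) (interval-split m a c) ⟩
    greedyIn s false (interval m a ++ j ∷ R)
  ≡⟨ greedy-skip (separated s) (isUp s) m a (j ∷ R)
       (λ i m≤i i<j → no-down-output m k s (suc j) i perm inv m≤i (s≤s i<j) (<-trans (s≤s i<j) j+1<m+k)) ⟩
    greedyIn s false (j ∷ R)
  ≡⟨ greedy-down-head (separated s) (isUp s) j R
       (trans (sym (downSep-reverse m k s j perm (m≤m+n m a) j+1<m+k)) down) ⟩
    suc (greedyIn s true R)
  ≡⟨ cong suc (greedy-flip (separated s) (isUp s) (separated s′) (isUp s′) (suc j) c flips true) ⟩
    suc (greedyIn s′ false R)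
  ∎
  where
    open ≡-Reasoning
    j = m + a
    k = suc (suc (a + c))
    R = interval (suc j) c
    s′ = stack (suc j) (reverse s)
    end : suc j + suc c ≡ m + k
    end = round-length m a c
    j+1<m+k : suc j < m + k
    j+1<m+k = subst (suc j <_) end (m<m+n (suc j) (s≤s z≤n))
    flips : OnInterval (λ i → separated s′ i ≡ separated s i × isUp s′ i ≡ not (isUp s i)) (suc j) c
    flips i j<i i<end = stack-pair m k s (suc j) i perm (≤-trans (m≤m+n m a) (n≤1+n j)) j<i
      (subst (suc i <_) end (subst (suc i <_) (sym (+-suc (suc j) c)) (s≤s i<end)))

interval-bound : ∀ m k i → m ≤ i → i < m + (k ∸ 1) → suc i < m + k
interval-bound m zero    i m≤i i<m = ⊥-elim (<⇒≱ (subst (i <_) (+-identityʳ m) i<m) m≤i)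
interval-bound m (suc k) i m≤i i<  = subst (suc i <_) (sym (+-suc m k)) (s≤s i<)

stack-finished : ∀ m k s m′ → PermOf m k s → m + k ≤ m′ → stack m′ (reverse s) ≡ []
stack-finished m k s m′ perm m+k≤m′ = filter-none (T? ∘ (m′ ≤ᵇ_)) (All.tabulate λ x∈ t →
  <⇒≱ (≤-trans (proj₂ (PermOf.bounded perm (Any.reverse⁻ x∈))) m+k≤m′) (≤ᵇ⇒≤ m′ _ t))

split-range : ∀ {m j k} → m ≤ j → suc j < m + k →
  Σ[ a ∈ ℕ ] Σ[ c ∈ ℕ ] j ≡ m + a × k ≡ suc (suc (a + c))
split-range {m} {j} {k} m≤j j+1<m+k with m≤n⇒∃[o]m+o≡n m≤j | m≤n⇒∃[o]m+o≡n j+1<m+k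
... | a , refl | c , m+k≡ = a , c , refl , +-cancelˡ-≡ m k _ (trans (sym m+k≡) (arith m a c))
  where arith : ∀ m a c → suc (suc (m + a)) + c ≡ m + suc (suc (a + c))
        arith = solve-∀

tier-formula : ∀ f m k s → PermOf m k s → k ≤ f →
  tierAux f m s ≡ greedyIn s false (interval m (k ∸ 1))
tier-formula zero    m zero s perm z≤n = refl
tier-formula (suc f) m k s perm k≤f+1
  with passSpec m s (Distinct-reverse s distinct) (All.tabulate (proj₁ ∘ bounded))
  where open PermOf perm
... | m′ , pass≡ , inv with pass m [] s | pass≡
... | _ | refl with m′ <? m + k
... | no m′≮m+k rewrite stack-finished m k s m′ perm (≮⇒≥ m′≮m+k) =
  sym (greedy-none (separated s) (isUp s) m (k ∸ 1) λ i m≤i i< →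
    let i+1<m+k = interval-bound m k i m≤i i< in
    no-down-output m k s m′ i perm inv m≤i (≤-trans i+1<m+k (≮⇒≥ m′≮m+k)) i+1<m+k)
... | yes m′<m+k with PassInvariant.nextBlocked inv (Any.reverse⁺ (PermOf.complete perm (PassInvariant.start≤next inv) m′<m+k))
...   | j , refl , m≤j , down with split-range m≤j m′<m+k
...     | a , c , refl , refl with stack (suc (m + a)) (reverse s) in st≡
...       | [] = ⊥-elim (Any.¬Any[] (subst (suc (m + a) ∈_) st≡ (on-stack (suc (m + a)) (reverse s)
                   (Any.reverse⁺ (PermOf.complete perm (PassInvariant.start≤next inv) m′<m+k)) ≤-refl)))
...       | y ∷ st =
  trans (cong suc (tier-formula f (suc (m + a)) (suc c) (y ∷ st) next-perm (≤-trans (s≤s (m≤n+m c a)) (s≤s⁻¹ k≤f+1))))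
        (sym (trans (tier-step m a c s perm inv down)
                    (cong (λ z → suc (greedyIn z false (interval (suc (m + a)) c))) st≡)))
  where
    next-perm : PermOf (suc (m + a)) (suc c) (y ∷ st)
    next-perm = subst (PermOf _ _) st≡
      (PermOf-stack m _ s (suc (m + a)) (suc c) perm (≤-trans (m≤m+n m a) (n≤1+n _)) (round-length m a c))

-- Among the separated indices
-- L = sepIdx σ, the greedy choice is optimal: no ISASP starting with
-- orientation b is longer than the greedy one, which is itself an ISASP.
-- Hence the maximum ISASP length is the larger greedy count, the two counts
-- differ by at most one, and σ is oriented towards b exactly when the greedy
-- count for b exceeds the other one.
module Orientation (σ : List ℕ) where

  picks : Bool → List ℕ → ℕ
  picks = greedy (λ _ → true) (isUp σ)

  Starts : Bool → List ℕ → Set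
  Starts b []      = ⊤
  Starts b (i ∷ _) = isUp σ i ≡ b

  picks-not : ∀ b L → picks (not b) L ≤ suc (picks b L)
  picks-not b     []      = z≤n
  picks-not true  (i ∷ L) with isUp σ i
  ... | true  = ≤-trans (n≤1+n _) (n≤1+n _)
  ... | false = ≤-refl
  picks-not false (i ∷ L) with isUp σ i
  ... | true  = ≤-refl
  ... | false = ≤-trans (n≤1+n _) (n≤1+n _)

  picks-∷ : ∀ b x L → picks b L ≤ picks b (x ∷ L)
  picks-∷ true  x L with isUp σ x
  ... | true  = picks-not false L
  ... | false = ≤-refl
  picks-∷ false x L with isUp σ x
  ... | true  = ≤-refl
  ... | false = picks-not true L

  alternating-tail : ∀ x s → alternating σ (x ∷ s) ≡ true → alternating σ s ≡ true
  alternating-tail x []      _ = refl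
  alternating-tail x (y ∷ s) e with isUp σ x ≠ᵇ isUp σ y
  ... | true = e

  alternating-next : ∀ x s b → alternating σ (x ∷ s) ≡ true → isUp σ x ≡ b → Starts (not b) s
  alternating-next x []      b _ _  = tt
  alternating-next x (y ∷ s) b e ux with isUp σ x | isUp σ y | ux | e
  ... | true  | false | refl | _ = refl
  ... | false | true  | refl | _ = refl
  ... | true  | true  | _    | ()
  ... | false | false | _    | ()

  alternating-∷ : ∀ x s b → isUp σ x ≡ b → Starts (not b) s → alternating σ s ≡ true →
    alternating σ (x ∷ s) ≡ true
  alternating-∷ x []      b     _    _  _ = refl
  alternating-∷ x (y ∷ s) true  ux uy a rewrite ux | uy = a
  alternating-∷ x (y ∷ s) false ux uy a rewrite ux | uy = a

  greedy-optimal : ∀ {s L} → s ⊆ L → alternating σ s ≡ true → ∀ b → Starts b s → length s ≤ picks b L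
  greedy-optimal []              _ b _ = z≤n
  greedy-optimal (x ∷ʳ sub)      a b h = ≤-trans (greedy-optimal sub a b h) (picks-∷ b x _)
  greedy-optimal {x ∷ s} (refl ∷ sub) a true  h rewrite h =
    s≤s (greedy-optimal sub (alternating-tail x s a) false (alternating-next x s true a h))
  greedy-optimal {x ∷ s} (refl ∷ sub) a false h rewrite h =
    s≤s (greedy-optimal sub (alternating-tail x s a) true (alternating-next x s false a h))

  greedyPick : Bool → List ℕ → List ℕ
  greedyPick b     []      = []
  greedyPick true  (i ∷ L) = if isUp σ i then i ∷ greedyPick false L else greedyPick true L
  greedyPick false (i ∷ L) = if isUp σ i then greedyPick false L else i ∷ greedyPick true L

  record IsGreedyPick (b : Bool) (L s : List ℕ) : Set where
    field
      sublist     : s ⊆ L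
      alternates  : alternating σ s ≡ true
      length≡picks : length s ≡ picks b L
      starts      : Starts b s

  picks-take : ∀ b i L → isUp σ i ≡ b → picks b (i ∷ L) ≡ suc (picks (not b) L)
  picks-take true  i L e rewrite e = refl
  picks-take false i L e rewrite e = refl

  picks-skip : ∀ b i L → isUp σ i ≡ not b → picks b (i ∷ L) ≡ picks b L
  picks-skip true  i L e rewrite e = refl
  picks-skip false i L e rewrite e = refl

  greedyPick-spec : ∀ b L → IsGreedyPick b L (greedyPick b L)
  greedyPick-spec b [] = record { sublist = [] ; alternates = refl ; length≡picks = refl ; starts = tt }
  greedyPick-spec true (i ∷ L) with isUp σ i in e
  ... | true = let open IsGreedyPick (greedyPick-spec false L) in record
    { sublist = refl ∷ sublist ; alternates = alternating-∷ i _ true e starts alternates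
    ; length≡picks = trans (cong suc length≡picks) (sym (picks-take true i L e)) ; starts = e }
  ... | false = let open IsGreedyPick (greedyPick-spec true L) in record
    { sublist = i ∷ʳ sublist ; alternates = alternates
    ; length≡picks = trans length≡picks (sym (picks-skip true i L e)) ; starts = starts }
  greedyPick-spec false (i ∷ L) with isUp σ i in e
  ... | true = let open IsGreedyPick (greedyPick-spec false L) in record
    { sublist = i ∷ʳ sublist ; alternates = alternates
    ; length≡picks = trans length≡picks (sym (picks-skip false i L e)) ; starts = starts }
  ... | false = let open IsGreedyPick (greedyPick-spec true L) in record
    { sublist = refl ∷ sublist ; alternates = alternating-∷ i _ false e starts alternates
    ; length≡picks = trans (cong suc length≡picks) (sym (picks-take false i L e)) ; starts = e }

  ∈-sublists⁻ : ∀ L {s} → s ∈ sublists L → s ⊆ L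
  ∈-sublists⁻ []      (here refl) = []
  ∈-sublists⁻ (x ∷ L) s∈ with Any.++⁻ (map (x ∷_) (sublists L)) s∈
  ... | inj₁ s∈₁ with ∈-map⁻ (x ∷_) s∈₁
  ...   | s′ , s′∈ , refl = refl ∷ ∈-sublists⁻ L s′∈
  ∈-sublists⁻ (x ∷ L) s∈ | inj₂ s∈₂ = x ∷ʳ ∈-sublists⁻ L s∈₂

  ∈-sublists⁺ : ∀ {s L} → s ⊆ L → s ∈ sublists L
  ∈-sublists⁺ []                       = here refl
  ∈-sublists⁺ {L = x ∷ L} (refl ∷ sub) = Any.++⁺ˡ (∈-map⁺ (x ∷_) (∈-sublists⁺ sub))
  ∈-sublists⁺ {L = x ∷ L} (x ∷ʳ sub)   = Any.++⁺ʳ (map (x ∷_) (sublists L)) (∈-sublists⁺ sub)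

  maxLength : List (List ℕ) → ℕ
  maxLength = foldr (λ s r → length s ⊔ r) zero

  ≤-maxLength : ∀ xs {s} → s ∈ xs → length s ≤ maxLength xs
  ≤-maxLength (x ∷ xs) (here refl) = m≤m⊔n (length x) (maxLength xs)
  ≤-maxLength (x ∷ xs) (there s∈)  = ≤-trans (≤-maxLength xs s∈) (m≤n⊔m (length x) (maxLength xs))

  maxLength-≤ : ∀ xs B → (∀ {s} → s ∈ xs → length s ≤ B) → maxLength xs ≤ B
  maxLength-≤ []       B _ = z≤n
  maxLength-≤ (x ∷ xs) B h = ⊔-lub (h (here refl)) (maxLength-≤ xs B (λ s∈ → h (there s∈)))

  L : List ℕ
  L = sepIdx σ

  M : ℕ
  M = maxISASPLength σ

  ∈-isasps⁻ : ∀ {s} → s ∈ isasps σ → s ⊆ L × alternating σ s ≡ true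
  ∈-isasps⁻ s∈ with ∈-filterᵇ⁻ (alternating σ) s∈
  ... | s∈′ , alt = ∈-sublists⁻ L s∈′ , alt

  greedyPick-∈ : ∀ b → greedyPick b L ∈ isasps σ
  greedyPick-∈ b = let open IsGreedyPick (greedyPick-spec b L) in
    ∈-filterᵇ⁺ (alternating σ) (∈-sublists⁺ sublist) alternates

  picks≤M : ∀ b → picks b L ≤ M
  picks≤M b = subst (_≤ M) (IsGreedyPick.length≡picks (greedyPick-spec b L))
                    (≤-maxLength (isasps σ) (greedyPick-∈ b))

  M≤picks : ∀ b → M ≤ picks b L ⊔ picks (not b) L
  M≤picks b = maxLength-≤ (isasps σ) _ bound
    where
      bound : ∀ {s} → s ∈ isasps σ → length s ≤ picks b L ⊔ picks (not b) L
      bound {[]}    _  = z≤n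
      bound {i ∷ s} s∈ with ∈-isasps⁻ s∈ | isUp σ i Bool.≟ b
      ... | sub , alt | yes ui = ≤-trans (greedy-optimal sub alt b ui) (m≤m⊔n _ _)
      ... | sub , alt | no ui  = ≤-trans (greedy-optimal sub alt (not b) (¬-not ui)) (m≤n⊔m _ _)

  Oriented : Bool → (List ℕ → Bool) → Bool
  Oriented b begins = not (null L) ∧ all (λ s → not (length s ≡ᵇ M) ∨ begins s) (isasps σ)

  oriented⇒ : ∀ b begins → begins [] ≡ false → (∀ i s → begins (i ∷ s) ≡ true → isUp σ i ≡ b) →
    Oriented b begins ≡ true → picks b L ≡ suc (picks (not b) L)
  oriented⇒ b begins begins[] begins⇒ oriented =
    ≤-antisym (subst (λ c → picks c L ≤ suc (picks (not b) L)) (not-involutive b) (picks-not (not b) L))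
              (≤-trans other<M M≤this)
    where
      allMaxBegin : all (λ s → not (length s ≡ᵇ M) ∨ begins s) (isasps σ) ≡ true
      allMaxBegin = conjunct (not (null L)) oriented
        where conjunct : ∀ a {c} → (a ∧ c) ≡ true → c ≡ true
              conjunct true e = e
      -- the greedy ISASP for ¬b does not begin with b, so it is not maximal
      other≢M : picks (not b) L ≢ M
      other≢M eq = wrongStart (greedyPick (not b) L) (IsGreedyPick.starts spec)
        (maximal⇒begins (all-true⁻ _ (isasps σ) allMaxBegin (greedyPick-∈ (not b)))
                         (trans (IsGreedyPick.length≡picks spec) eq))
        where
          spec = greedyPick-spec (not b) L
          maximal⇒begins : ∀ {s} → (not (length s ≡ᵇ M) ∨ begins s) ≡ true → length s ≡ M → begins s ≡ true
          maximal⇒begins {s} e len rewrite len | ≡ᵇ-refl M = e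
          wrongStart : ∀ s → Starts (not b) s → begins s ≢ true
          wrongStart []      _  e = not-¬ refl (trans (sym e) begins[])
          wrongStart (i ∷ s) ui e = not-¬ refl (trans (sym (begins⇒ i s e)) ui)
      other<M : picks (not b) L < M
      other<M = ≤∧≢⇒< (picks≤M (not b)) other≢M
      M≤this : M ≤ picks b L
      M≤this with ⊔-sel (picks b L) (picks (not b) L)
      ... | inj₁ e = subst (M ≤_) e (M≤picks b)
      ... | inj₂ e = ⊥-elim (<⇒≱ other<M (subst (M ≤_) e (M≤picks b)))

  oriented⇐ : ∀ b begins → (∀ i s → isUp σ i ≡ b → begins (i ∷ s) ≡ true) →
    picks b L ≡ suc (picks (not b) L) → Oriented b begins ≡ true
  oriented⇐ b begins ⇒begins more =
    trans (cong (_∧ all test (isasps σ)) nonempty) (all-true⁺ test (isasps σ) maxBegins)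
    where
      test : List ℕ → Bool
      test s = not (length s ≡ᵇ M) ∨ begins s
      nonempty : not (null L) ≡ true
      nonempty = positive L more
        where positive : ∀ L′ {n} → picks b L′ ≡ suc n → not (null L′) ≡ true
              positive (_ ∷ _) _ = refl
      M≡this : M ≡ picks b L
      M≡this = ≤-antisym
        (subst (M ≤_) (m≥n⇒m⊔n≡m (subst (picks (not b) L ≤_) (sym more) (n≤1+n _))) (M≤picks b))
        (picks≤M b)
      maxBegins : ∀ {s} → s ∈ isasps σ → test s ≡ true
      maxBegins {s} s∈ with length s ≡ᵇ M in e
      ... | false = refl
      ... | true with s | s∈ | ≡ᵇ-true⇒≡ (length s) M e
      ...   | [] | _ | len = ⊥-elim (0≢1+n (trans len (trans M≡this more)))
      ...   | i ∷ s′ | s∈′ | len with ∈-isasps⁻ s∈′ | isUp σ i Bool.≟ b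
      ...     | _ , _ | yes ui = ⇒begins i s′ ui
      ...     | sub , alt | no ui = ⊥-elim (<-irrefl refl
                  (subst (_≤ picks (not b) L) (trans len (trans M≡this more))
                         (greedy-optimal sub alt (not b) (¬-not ui))))

greedy-filter : ∀ (sp up : ℕ → Bool) b xs → greedy (λ _ → true) up b (filterᵇ sp xs) ≡ greedy sp up b xs
greedy-filter sp up b     [] = refl
greedy-filter sp up true  (x ∷ xs) with sp x
... | true  rewrite greedy-filter sp up false xs | greedy-filter sp up true xs = refl
... | false = greedy-filter sp up true xs
greedy-filter sp up false (x ∷ xs) with sp x
... | true  rewrite greedy-filter sp up false xs | greedy-filter sp up true xs = refl
... | false = greedy-filter sp up false xs

applyUpTo-interval : ∀ (g : ℕ → ℕ) a k → (∀ i → g i ≡ a + i) → applyUpTo g k ≡ interval a k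
applyUpTo-interval g a zero    _ = refl
applyUpTo-interval g a (suc k) h = cong₂ _∷_ (trans (h 0) (+-identityʳ a))
  (applyUpTo-interval (g ∘ suc) (suc a) k (λ i → trans (h (suc i)) (+-suc a i)))

alt : List ℕ → Bool → ℕ
alt σ b = greedyIn σ b (interval 1 (length σ ∸ 1))

picks≡alt : ∀ σ b → Orientation.picks σ b (sepIdx σ) ≡ alt σ b
picks≡alt σ b = trans (greedy-filter (separated σ) (isUp σ) b (applyUpTo suc (length σ ∸ 1)))
  (cong (greedyIn σ b) (applyUpTo-interval suc 1 (length σ ∸ 1) (λ _ → refl)))

upOriented⇔ : ∀ σ → upOriented σ ≡ true ⇔ alt σ true ≡ suc (alt σ false)
upOriented⇔ σ = mk⇔
  (λ up → trans (sym (picks≡alt σ true))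
            (trans (oriented⇒ true (beginsUp σ) refl (λ _ _ e → e) up) (cong suc (picks≡alt σ false))))
  (λ e → oriented⇐ true (beginsUp σ) (λ _ _ e → e)
            (trans (picks≡alt σ true) (trans e (cong suc (sym (picks≡alt σ false))))))
  where open Orientation σ

downOriented⇔ : ∀ σ → downOriented σ ≡ true ⇔ alt σ false ≡ suc (alt σ true)
downOriented⇔ σ = mk⇔
  (λ down → trans (sym (picks≡alt σ false))
            (trans (oriented⇒ false (beginsDown σ) refl (λ i _ e → not-true i e) down)
                   (cong suc (picks≡alt σ true))))
  (λ e → oriented⇐ false (beginsDown σ) (λ _ _ e → cong not e)
            (trans (picks≡alt σ false) (trans e (cong suc (sym (picks≡alt σ true))))))
  where
    open Orientation σ
    not-true : ∀ i → not (isUp σ i) ≡ true → isUp σ i ≡ false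
    not-true i e with isUp σ i
    ... | false = refl

IsPerm : ℕ → List ℕ → Set
IsPerm n σ = PermOf 1 n σ × length σ ≡ n

PermOf-reverse : ∀ {m k σ} → PermOf m k σ → PermOf m k (reverse σ)
PermOf-reverse {σ = σ} perm = record
  { distinct = Distinct-reverse σ distinct
  ; bounded  = λ x∈ → bounded (Any.reverse⁻ x∈)
  ; complete = λ m≤x x< → Any.reverse⁺ (complete m≤x x<)
  }
  where open PermOf perm

IsPerm-reverse : ∀ {n σ} → IsPerm n σ → IsPerm n (reverse σ)
IsPerm-reverse {σ = σ} (perm , len) = PermOf-reverse perm , trans (length-reverse σ) len

revTier≡alt : ∀ {n} σ → IsPerm n σ → revTier σ ≡ alt σ false
revTier≡alt σ (perm , refl) = tier-formula (suc (length σ)) 1 (length σ) σ perm (n≤1+n _)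

alt-reverse : ∀ {n} σ b → IsPerm n σ → alt (reverse σ) b ≡ alt σ (not b)
alt-reverse σ b (perm , refl) = begin
    greedyIn (reverse σ) b (interval 1 (length (reverse σ) ∸ 1))
  ≡⟨ cong₂ (λ c l → greedyIn (reverse σ) c (interval 1 (l ∸ 1))) (sym (not-involutive b)) (length-reverse σ) ⟩
    greedyIn (reverse σ) (not (not b)) I
  ≡⟨ sym (greedy-flip (separated σ) (isUp σ) (separated (reverse σ)) (isUp (reverse σ)) 1 (length σ ∸ 1) flips (not b)) ⟩
    greedyIn σ (not b) I
  ∎
  where
    open ≡-Reasoning
    I = interval 1 (length σ ∸ 1)
    flips : OnInterval (λ i → separated (reverse σ) i ≡ separated σ i × isUp (reverse σ) i ≡ not (isUp σ i))
              1 (length σ ∸ 1)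
    flips i 1≤i i< with PermOf-pair perm 1≤i (interval-bound 1 (length σ) i 1≤i i<)
    ... | i∈ , i+1∈ = separated-reverse σ i d i∈ i+1∈ , isUp-reverse σ i d i∈ i+1∈
      where d = PermOf.distinct perm

posOf-reverse : ∀ x σ → Distinct σ → x ∈ σ → posOf x (reverse σ) + suc (posOf x σ) ≡ length σ
posOf-reverse x σ d x∈ with ∈-∃++ x∈
... | u , w , refl with Distinct-++⁻ u d
... | _ , (x∉w , _) , disjoint = begin
    posOf x (reverse (u ++ x ∷ w)) + suc (posOf x (u ++ x ∷ w))
  ≡⟨ cong₂ (λ p q → p + suc q) (cong (posOf x) reverse≡) (posOf-at u w x∉u) ⟩
    posOf x (reverse w ++ x ∷ reverse u) + suc (length u)
  ≡⟨ cong (_+ suc (length u)) (trans (posOf-at (reverse w) (reverse u) (λ m → x∉w (Any.reverse⁻ m))) (length-reverse w)) ⟩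
    length w + suc (length u)
  ≡⟨ trans (+-suc (length w) (length u)) (cong suc (+-comm (length w) (length u))) ⟩
    suc (length u + length w)
  ≡⟨ sym (trans (length-++-sucʳ u x w) (cong suc (length-++ u))) ⟩
    length (u ++ x ∷ w)
  ∎
  where
    open ≡-Reasoning
    x∉u : ¬ x ∈ u
    x∉u m = disjoint m (here refl)
    reverse≡ : reverse (u ++ x ∷ w) ≡ reverse w ++ x ∷ reverse u
    reverse≡ = trans (reverse-++ u (x ∷ w))
                     (trans (cong (_++ reverse u) (unfold-reverse x w)) (++-assoc (reverse w) [ x ] (reverse u)))

upStat : ℕ → ℕ → List ℕ → Bool
upStat t k σ = upOriented σ ∧ (revTier σ ≡ᵇ t) ∧ (suc (posOf 1 σ) ≡ᵇ k)

downStat : ℕ → ℕ → List ℕ → Bool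
downStat t k σ = downOriented σ ∧ (revTier σ ≡ᵇ t) ∧ (suc (posOf 1 σ) ≡ᵇ k)

⇔⇒≡ : ∀ {x y : Bool} → (x ≡ true ⇔ y ≡ true) → x ≡ y
⇔⇒≡ {true}  {true}  _ = refl
⇔⇒≡ {false} {false} _ = refl
⇔⇒≡ {true}  {false} x⇔y = sym (Equivalence.to x⇔y refl)
⇔⇒≡ {false} {true}  x⇔y = Equivalence.from x⇔y refl

∧-cong-if : ∀ x {y z} → (x ≡ true → y ≡ z) → x ∧ y ≡ x ∧ z
∧-cong-if true  y≡z = y≡z refl
∧-cong-if false _   = refl

complementary : ∀ p′ p a b → p′ + suc p ≡ b + suc a → (p′ ≡ᵇ b) ≡ (p ≡ᵇ a)
complementary p′ p a b h = ⇔⇒≡ (mk⇔ to from)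
  where
    to : (p′ ≡ᵇ b) ≡ true → (p ≡ᵇ a) ≡ true
    to e with ≡ᵇ-true⇒≡ p′ b e
    ... | refl with suc-injective (+-cancelˡ-≡ p′ (suc p) (suc a) h)
    ...   | refl = ≡ᵇ-refl p
    from : (p ≡ᵇ a) ≡ true → (p′ ≡ᵇ b) ≡ true
    from e with ≡ᵇ-true⇒≡ p a e
    ... | refl with +-cancelʳ-≡ (suc p) p′ b h
    ...   | refl = ≡ᵇ-refl p′

oriented-reverse : ∀ {n} σ → IsPerm n σ → downOriented (reverse σ) ≡ upOriented σ
oriented-reverse σ isPerm = ⇔⇒≡ (mk⇔
  (λ down → Equivalence.from (upOriented⇔ σ)
    (trans (sym (swap false)) (trans (Equivalence.to (downOriented⇔ (reverse σ)) down) (cong suc (swap true)))))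
  (λ up → Equivalence.from (downOriented⇔ (reverse σ))
    (trans (swap false) (trans (Equivalence.to (upOriented⇔ σ) up) (cong suc (sym (swap true)))))))
  where
    swap : ∀ b → alt (reverse σ) b ≡ alt σ (not b)
    swap b = alt-reverse σ b isPerm

revTier-reverse : ∀ {n} σ → IsPerm n σ → upOriented σ ≡ true → revTier (reverse σ) ≡ suc (revTier σ)
revTier-reverse σ isPerm up = begin
  revTier (reverse σ)    ≡⟨ revTier≡alt (reverse σ) (IsPerm-reverse isPerm) ⟩
  alt (reverse σ) false  ≡⟨ alt-reverse σ false isPerm ⟩
  alt σ true             ≡⟨ Equivalence.to (upOriented⇔ σ) up ⟩
  suc (alt σ false)      ≡⟨ cong suc (revTier≡alt σ isPerm) ⟨
  suc (revTier σ)        ∎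
  where open ≡-Reasoning

position-reverse : ∀ n a b σ → IsPerm n σ → suc (a + b) ≡ n →
  (posOf 1 (reverse σ) ≡ᵇ b) ≡ (posOf 1 σ ≡ᵇ a)
position-reverse n a b σ (perm , len) n≡ = complementary _ _ a b (begin
  posOf 1 (reverse σ) + suc (posOf 1 σ) ≡⟨ posOf-reverse 1 σ (PermOf.distinct perm) 1∈σ ⟩
  length σ                              ≡⟨ trans len (sym n≡) ⟩
  suc (a + b)                           ≡⟨ cong suc (+-comm a b) ⟩
  suc (b + a)                           ≡⟨ +-suc b a ⟨
  b + suc a                             ∎)
  where
    open ≡-Reasoning
    1∈σ : 1 ∈ σ
    1∈σ = PermOf.complete perm ≤-refl (s≤s (subst (1 ≤_) n≡ (s≤s z≤n)))

reverse-correspondence : ∀ n t a b σ → IsPerm n σ → suc (a + b) ≡ n →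
  downStat (suc t) (suc b) (reverse σ) ≡ upStat t (suc a) σ
reverse-correspondence n t a b σ isPerm n≡ = begin
    downOriented (reverse σ) ∧ (revTier (reverse σ) ≡ᵇ suc t) ∧ (posOf 1 (reverse σ) ≡ᵇ b)
  ≡⟨ cong (_∧ ((revTier (reverse σ) ≡ᵇ suc t) ∧ (posOf 1 (reverse σ) ≡ᵇ b))) (oriented-reverse σ isPerm) ⟩
    upOriented σ ∧ (revTier (reverse σ) ≡ᵇ suc t) ∧ (posOf 1 (reverse σ) ≡ᵇ b)
  ≡⟨ ∧-cong-if (upOriented σ) (λ up →
       cong₂ _∧_ (cong (_≡ᵇ suc t) (revTier-reverse σ isPerm up)) (position-reverse n a b σ isPerm n≡)) ⟩
    upOriented σ ∧ (revTier σ ≡ᵇ t) ∧ (posOf 1 σ ≡ᵇ a)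
  ∎
  where open ≡-Reasoning

posOf-< : ∀ x σ → x ∈ σ → posOf x σ < length σ
posOf-< x (y ∷ σ) x∈ with y ≡ᵇ x in e
... | true  = s≤s z≤n
... | false with x∈
...   | here q   = ⊥-elim (≡ᵇ-false⇒≢ y x e (sym q))
...   | there x∈σ = s≤s (posOf-< x σ x∈σ)

-- A permutation of length n has no entry in position k > n (the empty
-- permutation is neither up- nor down-oriented), and a down-oriented
-- permutation has positive rev-tier.
stat-vanishes : ∀ (oriented : List ℕ → Bool) → oriented [] ≡ false → ∀ n t a σ → IsPerm n σ → n ≤ a →
  (oriented σ ∧ (revTier σ ≡ᵇ t) ∧ (suc (posOf 1 σ) ≡ᵇ suc a)) ≡ false
stat-vanishes oriented empty zero    t a []      _               _ rewrite empty = refl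
stat-vanishes oriented empty zero    t a (_ ∷ _) (_ , ())        _
stat-vanishes oriented empty (suc n) t a σ       (perm , len) n≤a =
  vanish (≢⇒≡ᵇ-false (posOf 1 σ) a (λ p≡a → <⇒≱ (subst (_< suc n) p≡a 1<) n≤a))
  where
    vanish : (posOf 1 σ ≡ᵇ a) ≡ false → (oriented σ ∧ (revTier σ ≡ᵇ t) ∧ (posOf 1 σ ≡ᵇ a)) ≡ false
    vanish e rewrite e = trans (cong (oriented σ ∧_) (∧-zeroʳ _)) (∧-zeroʳ _)
    1< : posOf 1 σ < suc n
    1< = subst (posOf 1 σ <_) len (posOf-< 1 σ (PermOf.complete perm ≤-refl (s≤s (s≤s z≤n))))

-- A down-oriented permutation has rev-tier = alt σ false > 0.
downStat-tier0 : ∀ n k σ → IsPerm n σ → downStat 0 k σ ≡ false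
downStat-tier0 n k σ isPerm with downOriented σ in down
... | false = refl
... | true rewrite trans (revTier≡alt σ isPerm) (Equivalence.to (downOriented⇔ σ) down) = refl

count-cong : ∀ (p q : List ℕ → Bool) xs → (∀ {σ} → σ ∈ xs → p σ ≡ q σ) → count p xs ≡ count q xs
count-cong p q []       _ = refl
count-cong p q (σ ∷ xs) h rewrite h (here refl) with q σ
... | true  = cong suc (count-cong p q xs (λ σ∈ → h (there σ∈)))
... | false = count-cong p q xs (λ σ∈ → h (there σ∈))

count-map : ∀ (p : List ℕ → Bool) (f : List ℕ → List ℕ) xs → count p (map f xs) ≡ count (p ∘ f) xs
count-map p f []       = refl
count-map p f (σ ∷ xs) with p (f σ)
... | true  = cong suc (count-map p f xs)
... | false = count-map p f xs

count-↭ : ∀ (p : List ℕ → Bool) {xs ys} → xs ↭ ys → count p xs ≡ count p ys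
count-↭ p ρ = ↭-length (filter-↭ (T? ∘ p) ρ)

count-none : ∀ (p : List ℕ → Bool) xs → (∀ {σ} → σ ∈ xs → p σ ≡ false) → count p xs ≡ 0
count-none p []       _ = refl
count-none p (σ ∷ xs) h rewrite h (here refl) = count-none p xs (λ σ∈ → h (there σ∈))

insertAll-snoc : ∀ x zs y →
  insertAll x (zs ++ [ y ]) ≡ map (_++ [ y ]) (insertAll x zs) ++ [ zs ++ y ∷ x ∷ [] ]
insertAll-snoc x []       y = refl
insertAll-snoc x (z ∷ zs) y = cong ((x ∷ z ∷ zs ++ [ y ]) ∷_) (begin
    map (z ∷_) (insertAll x (zs ++ [ y ]))
  ≡⟨ cong (map (z ∷_)) (insertAll-snoc x zs y) ⟩
    map (z ∷_) (map (_++ [ y ]) (insertAll x zs) ++ [ zs ++ y ∷ x ∷ [] ])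
  ≡⟨ map-++ (z ∷_) (map (_++ [ y ]) (insertAll x zs)) [ zs ++ y ∷ x ∷ [] ] ⟩
    map (z ∷_) (map (_++ [ y ]) (insertAll x zs)) ++ [ z ∷ zs ++ y ∷ x ∷ [] ]
  ≡⟨ cong (_++ [ z ∷ zs ++ y ∷ x ∷ [] ]) (map-∘ (insertAll x zs)) ⟨
    map ((z ∷_) ∘ (_++ [ y ])) (insertAll x zs) ++ [ z ∷ zs ++ y ∷ x ∷ [] ]
  ≡⟨ cong (_++ [ z ∷ zs ++ y ∷ x ∷ [] ]) (map-∘ (insertAll x zs)) ⟩
    map (_++ [ y ]) (map (z ∷_) (insertAll x zs)) ++ [ z ∷ zs ++ y ∷ x ∷ [] ]
  ∎)
  where open ≡-Reasoning

insertAll-reverse : ∀ x σ → insertAll x (reverse σ) ≡ reverse (map reverse (insertAll x σ))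
insertAll-reverse x []       = refl
insertAll-reverse x (y ∷ ys) = begin
    insertAll x (reverse (y ∷ ys))
  ≡⟨ cong (insertAll x) (unfold-reverse y ys) ⟩
    insertAll x (reverse ys ++ [ y ])
  ≡⟨ insertAll-snoc x (reverse ys) y ⟩
    map (_++ [ y ]) (insertAll x (reverse ys)) ++ [ reverse ys ++ y ∷ x ∷ [] ]
  ≡⟨ cong (λ z → map (_++ [ y ]) z ++ [ reverse ys ++ y ∷ x ∷ [] ]) (insertAll-reverse x ys) ⟩
    map (_++ [ y ]) (reverse (map reverse (insertAll x ys))) ++ [ reverse ys ++ y ∷ x ∷ [] ]
  ≡⟨ cong₂ (λ z w → z ++ [ w ]) (reverse-map (_++ [ y ]) (map reverse (insertAll x ys))) (sym reverse₃) ⟩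
    reverse (map (_++ [ y ]) (map reverse (insertAll x ys))) ++ [ reverse (x ∷ y ∷ ys) ]
  ≡⟨ cong (λ z → reverse z ++ [ reverse (x ∷ y ∷ ys) ]) (sym (map-reverse-∷ (insertAll x ys))) ⟩
    reverse (map reverse (map (y ∷_) (insertAll x ys))) ++ [ reverse (x ∷ y ∷ ys) ]
  ≡⟨ sym (unfold-reverse (reverse (x ∷ y ∷ ys)) (map reverse (map (y ∷_) (insertAll x ys)))) ⟩
    reverse (map reverse (insertAll x (y ∷ ys)))
  ∎
  where
    open ≡-Reasoning
    reverse₃ : reverse (x ∷ y ∷ ys) ≡ reverse ys ++ y ∷ x ∷ []
    reverse₃ = trans (unfold-reverse x (y ∷ ys))
                 (trans (cong (_++ [ x ]) (unfold-reverse y ys)) (++-assoc (reverse ys) [ y ] [ x ]))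
    map-reverse-∷ : ∀ L → map reverse (map (y ∷_) L) ≡ map (_++ [ y ]) (map reverse L)
    map-reverse-∷ []      = refl
    map-reverse-∷ (τ ∷ L) = cong₂ _∷_ (unfold-reverse y τ) (map-reverse-∷ L)

concatMap-↭ : ∀ (f : List ℕ → List (List ℕ)) {xs ys} → xs ↭ ys → concatMap f xs ↭ concatMap f ys
concatMap-↭ f ↭.refl           = ↭.refl
concatMap-↭ f (↭.prep x ρ)     = ++⁺ˡ (f x) (concatMap-↭ f ρ)
concatMap-↭ f (↭.swap x y ρ)   = ↭.trans (shifts (f x) (f y)) (++⁺ˡ (f y) (++⁺ˡ (f x) (concatMap-↭ f ρ)))
concatMap-↭ f (↭.trans ρ₁ ρ₂) = ↭.trans (concatMap-↭ f ρ₁) (concatMap-↭ f ρ₂)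

concatMap-pointwise : ∀ (f g : List ℕ → List (List ℕ)) xs → (∀ x → f x ↭ g x) →
  concatMap f xs ↭ concatMap g xs
concatMap-pointwise f g []       _ = ↭.refl
concatMap-pointwise f g (x ∷ xs) h = ++⁺ (h x) (concatMap-pointwise f g xs h)

perms-reverse : ∀ n → map reverse (perms n) ↭ perms n
perms-reverse zero    = ↭.refl
perms-reverse (suc n) = begin
  map reverse (concatMap (insertAll (suc n)) (perms n))  ≡⟨ map-concatMap reverse (insertAll (suc n)) (perms n) ⟩
  concatMap (map reverse ∘ insertAll (suc n)) (perms n)   ↭⟨ concatMap-pointwise _ _ (perms n) reversed-insertions ⟩
  concatMap (insertAll (suc n) ∘ reverse) (perms n)       ≡⟨ concatMap-map (insertAll (suc n)) reverse (perms n) ⟨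
  concatMap (insertAll (suc n)) (map reverse (perms n))  ↭⟨ concatMap-↭ (insertAll (suc n)) (perms-reverse n) ⟩
  concatMap (insertAll (suc n)) (perms n)                ∎
  where
    open PermutationReasoning
    reversed-insertions : ∀ σ → map reverse (insertAll (suc n) σ) ↭ insertAll (suc n) (reverse σ)
    reversed-insertions σ = ↭.↭-trans (↭.↭-sym (↭-reverse _)) (↭.↭-reflexive (sym (insertAll-reverse (suc n) σ)))

∈-concatMap⁻ : ∀ (f : List ℕ → List (List ℕ)) xs {σ} → σ ∈ concatMap f xs →
  Σ[ τ ∈ List ℕ ] τ ∈ xs × σ ∈ f τ
∈-concatMap⁻ f (x ∷ xs) σ∈ with Any.++⁻ (f x) σ∈
... | inj₁ σ∈fx = x , here refl , σ∈fx
... | inj₂ σ∈r  = let (τ , τ∈ , σ∈fτ) = ∈-concatMap⁻ f xs σ∈r in τ , there τ∈ , σ∈fτ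

∈-insertAll⁻ : ∀ x τ {σ} → σ ∈ insertAll x τ →
  Σ[ u ∈ List ℕ ] Σ[ w ∈ List ℕ ] τ ≡ u ++ w × σ ≡ u ++ x ∷ w
∈-insertAll⁻ x []       (here refl) = [] , [] , refl , refl
∈-insertAll⁻ x (y ∷ ys) (here refl) = [] , y ∷ ys , refl , refl
∈-insertAll⁻ x (y ∷ ys) (there σ∈) with ∈-map⁻ (y ∷_) σ∈
... | ζ , ζ∈ , refl with ∈-insertAll⁻ x ys ζ∈
...   | u , w , refl , refl = y ∷ u , w , refl , refl

IsPerm-insert : ∀ n u w → IsPerm n (u ++ w) → IsPerm (suc n) (u ++ suc n ∷ w)
IsPerm-insert n u w (perm , len) = record
  { distinct = distinct′ ; bounded = bounded′ ; complete = complete′ } , length′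
  where
    open PermOf perm
    x = suc n
    x∉ : ¬ x ∈ u ++ w
    x∉ x∈ = <-irrefl refl (proj₂ (bounded x∈))
    distinct′ : Distinct (u ++ x ∷ w)
    distinct′ with Distinct-++⁻ u distinct
    ... | du , dw , disjoint = Distinct-++⁺ u du ((λ x∈w → x∉ (Any.++⁺ʳ u x∈w)) , dw)
      λ { y∈u (here refl) → x∉ (Any.++⁺ˡ y∈u) ; y∈u (there y∈w) → disjoint y∈u y∈w }
    bounded′ : ∀ {y} → y ∈ u ++ x ∷ w → 1 ≤ y × y < 1 + x
    bounded′ y∈ with Any.++⁻ u y∈
    ... | inj₁ y∈u          = let (1≤y , y<) = bounded (Any.++⁺ˡ y∈u) in 1≤y , ≤-trans y< (n≤1+n _)
    ... | inj₂ (here refl)  = s≤s z≤n , ≤-refl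
    ... | inj₂ (there y∈w)  = let (1≤y , y<) = bounded (Any.++⁺ʳ u y∈w) in 1≤y , ≤-trans y< (n≤1+n _)
    complete′ : ∀ {y} → 1 ≤ y → y < 1 + x → y ∈ u ++ x ∷ w
    complete′ {y} 1≤y (s≤s y≤x) with m≤n⇒m<n∨m≡n y≤x
    ... | inj₁ y<x with Any.++⁻ u (complete 1≤y y<x)
    ...   | inj₁ y∈u = Any.++⁺ˡ y∈u
    ...   | inj₂ y∈w = Any.++⁺ʳ u (there y∈w)
    complete′ {y} 1≤y (s≤s y≤x) | inj₂ refl = Any.++⁺ʳ u (here refl)
    length′ : length (u ++ x ∷ w) ≡ suc n
    length′ = trans (length-++-sucʳ u x w) (cong suc len)

perms-IsPerm : ∀ n {σ} → σ ∈ perms n → IsPerm n σ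
perms-IsPerm zero    (here refl) =
  record { distinct = tt ; bounded = λ () ; complete = λ 1≤x x<1 → ⊥-elim (<⇒≱ x<1 1≤x) } , refl
perms-IsPerm (suc n) σ∈ with ∈-concatMap⁻ (insertAll (suc n)) (perms n) σ∈
... | τ , τ∈ , σ∈ins with ∈-insertAll⁻ (suc n) τ σ∈ins
...   | u , w , refl , refl = IsPerm-insert n u w (perms-IsPerm n τ∈)

μU≡μD : ∀ n t a b → suc (a + b) ≡ n → μU n t (suc a) ≡ μD n (suc t) (suc b)
μU≡μD n t a b n≡ = begin
    count (upStat t (suc a)) (perms n)
  ≡⟨ count-cong _ _ (perms n) (λ σ∈ → sym (reverse-correspondence n t a b _ (perms-IsPerm n σ∈) n≡)) ⟩
    count (downStat (suc t) (suc b) ∘ reverse) (perms n)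
  ≡⟨ count-map (downStat (suc t) (suc b)) reverse (perms n) ⟨
    count (downStat (suc t) (suc b)) (map reverse (perms n))
  ≡⟨ count-↭ (downStat (suc t) (suc b)) (perms-reverse n) ⟩
    count (downStat (suc t) (suc b)) (perms n)
  ∎
  where open ≡-Reasoning

μU-vanishes : ∀ n t a → n ≤ a → μU n t (suc a) ≡ 0
μU-vanishes n t a n≤a = count-none (upStat t (suc a)) (perms n)
  (λ σ∈ → stat-vanishes upOriented refl n t a _ (perms-IsPerm n σ∈) n≤a)

μD-vanishes : ∀ n t a → n ≤ a → μD n t (suc a) ≡ 0
μD-vanishes n t a n≤a = count-none (downStat t (suc a)) (perms n)
  (λ σ∈ → stat-vanishes downOriented refl n t a _ (perms-IsPerm n σ∈) n≤a)

μD-tier0 : ∀ n k → μD n 0 k ≡ 0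
μD-tier0 n k = count-none (downStat 0 k) (perms n) (λ σ∈ → downStat-tier0 n k _ (perms-IsPerm n σ∈))

-- A coefficient sequence a ↦ F a, as the coefficient of w^a, extended by 0
-- to negative exponents.
extend : (ℕ → ℕ) → ℤ → ℕ
extend F (+ a)     = F a
extend F -[1+ _ ] = 0

MU-extend : ∀ n t e → MU n (+ t) e ≡ extend (λ a → μU n t (suc a)) e
MU-extend n t (+ _)     = refl
MU-extend n t -[1+ _ ] = refl

MD-extend : ∀ n t e → MD n (+ t) e ≡ extend (λ a → μD n t (suc a)) e
MD-extend n t (+ _)     = refl
MD-extend n t -[1+ _ ] = refl

MD-tier0 : ∀ n e → MD n (+ 0) e ≡ 0
MD-tier0 n (+ a)     = μD-tier0 n (suc a)
MD-tier0 n -[1+ _ ] = refl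

-- If F a = H b whenever a + b + 1 = n, and both vanish from n on, then the
-- substitution w ↦ 1/w composed with multiplication by w^n turns F into w·H:
-- the coefficient of w^(n-e) in F is the coefficient of w^(e-1) in H.
reflect-coefficients : ∀ (F H : ℕ → ℕ) n → (∀ a → n ≤ a → F a ≡ 0) → (∀ b → n ≤ b → H b ≡ 0) →
  (∀ a b → suc (a + b) ≡ n → F a ≡ H b) → ∀ e → extend F (+ n - e) ≡ extend H (e - + 1)
reflect-coefficients F H n F0 H0 FH (+ zero)  = F0 (n + 0) (m≤m+n n 0)
reflect-coefficients F H n F0 H0 FH -[1+ k ] = F0 (n + suc k) (m≤m+n n (suc k))
reflect-coefficients F H n F0 H0 FH (+ suc k) with n <ᵇ suc k in lt
... | true  rewrite +-∸-assoc 1 (s≤s⁻¹ (<ᵇ-true⇒< n (suc k) lt)) =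
  sym (H0 k (s≤s⁻¹ (<ᵇ-true⇒< n (suc k) lt)))
... | false = FH (n ∸ suc k) k (trans (sym (+-suc (n ∸ suc k) k)) (m∸n+n≡m (<ᵇ-false⇒≥ n (suc k) lt)))

substituted-MU : substXW MU ≈ₛ mulWOverY MD
substituted-MU n (+ t) e = begin
    MU n (+ t) (+ n - e)
  ≡⟨ MU-extend n t (+ n - e) ⟩
    extend (λ a → μU n t (suc a)) (+ n - e)
  ≡⟨ reflect-coefficients _ _ n (μU-vanishes n t) (μD-vanishes n (suc t)) (μU≡μD n t) e ⟩
    extend (λ b → μD n (suc t) (suc b)) (e - + 1)
  ≡⟨ MD-extend n (suc t) (e - + 1) ⟨
    MD n (+ suc t) (e - + 1)
  ≡⟨ cong (λ s → MD n (+ s) (e - + 1)) (+-comm 1 t) ⟩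
    mulWOverY MD n (+ t) e
  ∎
  where open ≡-Reasoning
substituted-MU n -[1+ zero  ] e = sym (MD-tier0 n (e - + 1))
substituted-MU n -[1+ suc t ] e = refl

substituted-MD : substXW MD ≈ₛ mulWY MU
substituted-MD n (+ zero)  e = MD-tier0 n (+ n - e)
substituted-MD n (+ suc t) e = begin
    MD n (+ suc t) (+ n - e)
  ≡⟨ MD-extend n (suc t) (+ n - e) ⟩
    extend (λ a → μD n (suc t) (suc a)) (+ n - e)
  ≡⟨ reflect-coefficients _ _ n (μD-vanishes n (suc t)) (μU-vanishes n t)
       (λ a b n≡ → sym (μU≡μD n t b a (trans (cong suc (+-comm b a)) n≡))) e ⟩
    extend (λ b → μU n t (suc b)) (e - + 1)
  ≡⟨ MU-extend n t (e - + 1) ⟨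
    mulWY MU n (+ suc t) e
  ∎
  where open ≡-Reasoning
substituted-MD n -[1+ t ] e = refl

mainTheorem13 : (substXW MU ≈ₛ mulWOverY MD) × (substXW MD ≈ₛ mulWY MU)
mainTheorem13 = substituted-MU , substituted-MD
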